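{- It is decidable in time $O(n!\,m)$ whether or not the set of all columns of an arbitrary $m\times n$ boolean matrix is independent.
   Context: A boolean matrix (entries $0,1$) is nonsingular if, after independently permuting rows and columns, it is a square lower unitriangular matrix (ones on the diagonal, zeros above it). A set $X$ of columns of a boolean matrix $M$ with row set $R$ is independent if there is a set of rows $Y\subseteq R$ such that the submatrix $M[Y,X]$ is nonsingular. Time is measured as the number of elementary operations. -}

module Defs where

open import Data.Nat using (ℕ; zero; suc; _+_; _*_; _∸_; _<_)
open import Data.Nat.Properties using (_≟_)
open import Data.Bool using (Bool; true; false)
open import Data.Fin using (Fin)
open import Data.Fin.Subset using (Subset; _∈_; ⊤)
open import Data.List using (List; []; _∷_; concatMap; map; allFin)
open import Data.Maybe using (Maybe; just; nothing)
open import Data.Product using (Σ; ∃; _×_; _,_)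
open import Data.Sum using (_⊎_)
open import Function.Definitions using (Injective)
open import Relation.Binary.PropositionalEquality using (_≡_)
open import Relation.Nullary using (¬_; yes; no)

BoolMatrix : ℕ → ℕ → Set
BoolMatrix m n = Fin m → Fin n → Bool

-- The submatrix M[Y,X] (Y a set of rows, X a set of columns) is
-- nonsingular: after independently permuting rows and columns it is a
-- square lower unitriangular matrix.
record NonsingularOn {m n : ℕ} (M : BoolMatrix m n)
                     (Y : Subset m) (X : Subset n) : Set where
  field
    k      : ℕ
    r      : Fin k → Fin m
    c      : Fin k → Fin n
    r-inj  : Injective _≡_ _≡_ r
    c-inj  : Injective _≡_ _≡_ c
    r-in   : ∀ i → r i ∈ Y
    c-in   : ∀ i → c i ∈ X
    r-onto : ∀ y → y ∈ Y → ∃ λ i → r i ≡ y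
    c-onto : ∀ x → x ∈ X → ∃ λ i → c i ≡ x
    diag   : ∀ i → M (r i) (c i) ≡ true
    upper  : ∀ i j → Data.Fin._<_ i j → M (r i) (c j) ≡ false

Independent : {m n : ℕ} → BoolMatrix m n → Subset n → Set
Independent {m} M X = Σ (Subset m) λ Y → NonsingularOn M Y X

AllColumnsIndependent : {m n : ℕ} → BoolMatrix m n → Set
AllColumnsIndependent {n = n} M = Independent M ⊤

-- Machine model: a unit-cost RAM (addition and truncated subtraction,
-- indirect addressing, conditional jump).  One executed instruction =
-- one elementary operation.

data Instr : Set where
  const : (d v : ℕ) → Instr
  add   : (d a b : ℕ) → Instr
  sub   : (d a b : ℕ) → Instr
  load  : (d a : ℕ) → Instr
  store : (a s : ℕ) → Instr
  jmp   : (t : ℕ) → Instr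
  jz    : (r t : ℕ) → Instr
  halt  : Instr

Program : Set
Program = List Instr

Memory : Set
Memory = ℕ → ℕ

update : Memory → ℕ → ℕ → Memory
update mem a v x with x ≟ a
... | yes _ = v
... | no  _ = mem x

fetch : Program → ℕ → Maybe Instr
fetch []       _       = nothing
fetch (i ∷ _)  zero    = just i
fetch (_ ∷ is) (suc p) = fetch is p

stepI : Instr → ℕ → Memory → ℕ × Memory
stepI (const d v)   pc mem = suc pc , update mem d v
stepI (add d a b)   pc mem = suc pc , update mem d (mem a + mem b)
stepI (sub d a b)   pc mem = suc pc , update mem d (mem a ∸ mem b)
stepI (load d a)    pc mem = suc pc , update mem d (mem (mem a))
stepI (store a s)   pc mem = suc pc , update mem (mem a) (mem s)
stepI (jmp t)       pc mem = t , mem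
stepI (jz r t)      pc mem with mem r
... | zero  = t , mem
... | suc _ = suc pc , mem
stepI halt          pc mem = pc , mem

run : ℕ → Program → ℕ → Memory → Maybe Memory
run t P pc mem with fetch P pc
... | nothing   = just mem
... | just halt = just mem
run zero    P pc mem | just _ = nothing
run (suc t) P pc mem | just i with stepI i pc mem
... | pc' , mem' = run t P pc' mem'

at : List ℕ → ℕ → ℕ
at []       _       = 0
at (v ∷ _)  zero    = v
at (_ ∷ vs) (suc k) = at vs k

bit : Bool → ℕ
bit true  = 1
bit false = 0

-- Input encoding of an m × n boolean matrix: address 0 holds m,
-- address 1 holds n, address 2 + i*n + j holds entry (i,j) (row-major),
-- all other cells hold 0.
encode : {m n : ℕ} → BoolMatrix m n → Memory
encode {m} {n} M =
  at (m ∷ n ∷ concatMap (λ i → map (λ j → bit (M i j)) (allFin n)) (allFin m))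

-- Output convention: on halting, address 0 holds 1 if the answer is
-- "yes" and 0 if it is "no".
Decides : {m n : ℕ} → BoolMatrix m n → ℕ → Set
Decides M out = (out ≡ 1 × AllColumnsIndependent M)
              ⊎ (out ≡ 0 × ¬ AllColumnsIndependent M)

-- A set of columns is independent exactly when it can be peeled: repeatedly take a row with a single 1
-- among the columns not yet removed and remove that column.  If M[Y,X] is unitriangular in the orders
-- r, c, then among the remaining columns the c i with i least is the only remaining 1 of row r i;
-- conversely the rows and columns, in the order they were used and removed, form a unitriangular
-- submatrix.  So for an independent matrix every sweep over the m rows removes a column, and n sweeps,
-- each reading n entries per row, decide independence in O(n² m) ⊆ O(n! m) steps.
--
-- The RAM has no scratch space: every cell from 2 on belongs to the input.  The program therefore
-- first branches on the entries in cells 2, 3 and 4, keeping their values in the program counter,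
-- uses the freed cells to compute the input size, and copies the matrix above the input, after which
-- the cells below 22 serve as registers.
module Submission where

open import Defs
open import Data.Nat
open import Data.Nat.Properties
open import Data.Bool using (Bool; true; false; T; _∧_; if_then_else_)
open import Data.Bool.Properties using (∧-conicalˡ; ∧-conicalʳ)
open import Data.Unit using (⊤; tt)
open import Data.Empty using (⊥; ⊥-elim)
open import Data.List using (List; []; _∷_; _++_; length; drop)
open import Data.Maybe using (just)
open import Data.Product using (Σ; ∃; _×_; _,_; proj₁; proj₂)
open import Data.Sum using (_⊎_; inj₁; inj₂)
open import Function using (id; _∘_; case_of_)
open import Relation.Binary.PropositionalEquality
open import Relation.Nullary using (¬_; Dec; yes; no; does)
open import Relation.Nullary.Decidable using (dec-true)
open import Relation.Binary using (tri<; tri≈; tri>)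
import Data.Fin as Fin
open Fin using (Fin; toℕ; fromℕ<) renaming (_<_ to _<ᶠ_)
open import Data.Fin.Subset using (Subset; _∈_) renaming (⊥ to ∅)
open import Data.Fin.Subset.Properties using (∈⊤; ∉⊥)
open import Data.Fin.Properties using (toℕ<n; toℕ-fromℕ<; toℕ-injective; any?) renaming (_≟_ to _≟ᶠ_)

≡ᵇ-refl : ∀ k → (k ≡ᵇ k) ≡ true
≡ᵇ-refl zero    = refl
≡ᵇ-refl (suc k) = ≡ᵇ-refl k

≡ᵇ-true⇒≡ : ∀ {a b} → (a ≡ᵇ b) ≡ true → a ≡ b
≡ᵇ-true⇒≡ {a} {b} e = ≡ᵇ⇒≡ a b (subst T (sym e) tt)

≡ᵇ-false⇒≢ : ∀ {a b} → (a ≡ᵇ b) ≡ false → a ≢ b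
≡ᵇ-false⇒≢ {a} e refl = case trans (sym e) (≡ᵇ-refl a) of λ ()

module Machine where

  NonHalt : Instr → Set
  NonHalt halt = ⊥
  NonHalt _    = ⊤

  data Exec (P : Program) : ℕ → Memory → ℕ → ℕ → Memory → Set where
    done : ∀ {pc mem} → Exec P pc mem 0 pc mem
    step : ∀ {pc mem i pc₁ mem₁ k pc' mem'} → fetch P pc ≡ just i → NonHalt i →
           stepI i pc mem ≡ (pc₁ , mem₁) → Exec P pc₁ mem₁ k pc' mem' →
           Exec P pc mem (suc k) pc' mem'

  exec-++ : ∀ {P pc mem k pc₁ mem₁ k' pc₂ mem₂} → Exec P pc mem k pc₁ mem₁ →
            Exec P pc₁ mem₁ k' pc₂ mem₂ → Exec P pc mem (k + k') pc₂ mem₂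
  exec-++ done              e₂ = e₂
  exec-++ (step f nh s e₁) e₂ = step f nh s (exec-++ e₁ e₂)

  run-step : ∀ {P pc mem i pc₁ mem₁} t → fetch P pc ≡ just i → NonHalt i →
             stepI i pc mem ≡ (pc₁ , mem₁) → run (suc t) P pc mem ≡ run t P pc₁ mem₁
  run-step {P} {pc} t f nh s with fetch P pc
  run-step {i = halt}        t refl () s    | just .halt
  run-step {i = const _ _}   t refl _  refl | just ._ = refl
  run-step {i = add _ _ _}   t refl _  refl | just ._ = refl
  run-step {i = sub _ _ _}   t refl _  refl | just ._ = refl
  run-step {i = load _ _}    t refl _  refl | just ._ = refl
  run-step {i = store _ _}   t refl _  refl | just ._ = refl
  run-step {i = jmp _}       t refl _  refl | just ._ = refl
  run-step {i = jz _ _}      t refl _  s    | just ._ rewrite s = refl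

  run-exec : ∀ {P pc mem k pc' mem'} → Exec P pc mem k pc' mem' → ∀ t →
             run (k + t) P pc mem ≡ run t P pc' mem'
  run-exec done                           t = refl
  run-exec {P} (step {k = k} f nh s e) t = trans (run-step {P} (k + t) f nh s) (run-exec e t)

  run-halt : ∀ {P pc mem} → fetch P pc ≡ just halt → ∀ t → run t P pc mem ≡ just mem
  run-halt {P} {pc} f t with fetch P pc
  run-halt refl zero    | just .halt = refl
  run-halt refl (suc t) | just .halt = refl

  run-exec-halt : ∀ {P pc mem k pc' mem'} → Exec P pc mem k pc' mem' → fetch P pc' ≡ just halt →
                  ∀ t → k ≤ t → run t P pc mem ≡ just mem'
  run-exec-halt {P} {pc} {mem} {k} {pc'} {mem'} e h t k≤t = begin
      run t P pc mem             ≡⟨ cong (λ s → run s P pc mem) (sym (m+[n∸m]≡n k≤t)) ⟩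
      run (k + (t ∸ k)) P pc mem ≡⟨ run-exec e (t ∸ k) ⟩
      run (t ∸ k) P pc' mem'     ≡⟨ run-halt {P} {pc'} h (t ∸ k) ⟩
      just mem'                  ∎
    where open ≡-Reasoning

  jz-zero : ∀ r {t pc mem} → mem r ≡ 0 → stepI (jz r t) pc mem ≡ (t , mem)
  jz-zero r {mem = mem} e with mem r
  ... | zero = refl
  jz-zero r {mem = mem} () | suc _

  jz-suc : ∀ r {t pc mem v} → mem r ≡ suc v → stepI (jz r t) pc mem ≡ (suc pc , mem)
  jz-suc r {mem = mem} e with mem r
  jz-suc r {mem = mem} () | zero
  ... | suc _ = refl

  update-same : ∀ mem a v → update mem a v a ≡ v
  update-same mem a v with a ≟ a
  ... | yes _ = refl
  ... | no ne = ⊥-elim (ne refl)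

  update-other : ∀ mem a v x → x ≢ a → update mem a v x ≡ mem x
  update-other mem a v x ne with x ≟ a
  ... | yes e = ⊥-elim (ne e)
  ... | no _  = refl

  update-below : ∀ mem a v x → x < a → update mem a v x ≡ mem x
  update-below mem a v x x<a = update-other mem a v x (<⇒≢ x<a)

  update-above : ∀ mem a v x → a < x → update mem a v x ≡ mem x
  update-above mem a v x a<x = update-other mem a v x (>⇒≢ a<x)

  -- The bound is phrased with _<ᵇ_ so that for concrete offsets it is discharged by tt.
  CodeAt : Program → ℕ → Program → Set
  CodeAt P pc code = ∀ i → T (i <ᵇ length code) → fetch P (i + pc) ≡ fetch code i

  fetch-++ˡ : ∀ A B i → T (i <ᵇ length A) → fetch (A ++ B) i ≡ fetch A i
  fetch-++ˡ (a ∷ A) B zero    _ = refl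
  fetch-++ˡ (a ∷ A) B (suc i) p = fetch-++ˡ A B i p

  fetch-drop : ∀ P pc i → fetch P (pc + i) ≡ fetch (drop pc P) i
  fetch-drop P       zero     i = refl
  fetch-drop []      (suc pc) i = refl
  fetch-drop (_ ∷ P) (suc pc) i = fetch-drop P pc i

  -- For concrete arguments the hypothesis is proved by refl, the remainder being found by unification.
  codeAt-drop : ∀ P pc code {rest} → drop pc P ≡ code ++ rest → CodeAt P pc code
  codeAt-drop P pc code {rest} e i p = begin
      fetch P (i + pc)         ≡⟨ cong (fetch P) (+-comm i pc) ⟩
      fetch P (pc + i)         ≡⟨ fetch-drop P pc i ⟩
      fetch (drop pc P) i      ≡⟨ cong (λ Q → fetch Q i) e ⟩
      fetch (code ++ rest) i   ≡⟨ fetch-++ˡ code rest i p ⟩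
      fetch code i             ∎
    where open ≡-Reasoning

  record Runs (P : Program) (pc : ℕ) (mem : Memory) (pc' : ℕ) (Q : Memory → Set) (B : ℕ) : Set where
    constructor runs
    field
      steps : ℕ
      mem'  : Memory
      exec  : Exec P pc mem steps pc' mem'
      bound : steps ≤ B
      post  : Q mem'

  infixl 1 _>>>_ _>>>⊎_

  _>>>_ : ∀ {P pc mem pc₁ Q₁ B₁ pc₂ Q₂ B₂} → Runs P pc mem pc₁ Q₁ B₁ →
          (∀ m₁ → Q₁ m₁ → Runs P pc₁ m₁ pc₂ Q₂ B₂) → Runs P pc mem pc₂ Q₂ (B₁ + B₂)
  runs k m₁ e b q >>> f with f m₁ q
  ... | runs k' m₂ e' b' q' = runs (k + k') m₂ (exec-++ e e') (+-mono-≤ b b') q'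

  _>>>⊎_ : ∀ {P pc mem pc₁ Q₁ B₁ a b Qa Qb B₂} → Runs P pc mem pc₁ Q₁ B₁ →
           (∀ m₁ → Q₁ m₁ → Runs P pc₁ m₁ a Qa B₂ ⊎ Runs P pc₁ m₁ b Qb B₂) →
           Runs P pc mem a Qa (B₁ + B₂) ⊎ Runs P pc mem b Qb (B₁ + B₂)
  runs k m₁ e b q >>>⊎ f with f m₁ q
  ... | inj₁ (runs k' m₂ e' b' q') = inj₁ (runs (k + k') m₂ (exec-++ e e') (+-mono-≤ b b') q')
  ... | inj₂ (runs k' m₂ e' b' q') = inj₂ (runs (k + k') m₂ (exec-++ e e') (+-mono-≤ b b') q')

  weaken : ∀ {P pc mem pc' Q B B'} → B ≤ B' → Runs P pc mem pc' Q B → Runs P pc mem pc' Q B'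
  weaken le (runs k m e b q) = runs k m e (≤-trans b le) q

  mapPost : ∀ {P pc mem pc' Q Q' B} → (∀ m → Q m → Q' m) → Runs P pc mem pc' Q B → Runs P pc mem pc' Q' B
  mapPost f (runs k m e b q) = runs k m e b (f m q)

  fromExec : ∀ {P pc mem k pc' mem'} {Q : Memory → Set} → Exec P pc mem k pc' mem' → Q mem' → Runs P pc mem pc' Q k
  fromExec {k = k} e q = runs k _ e ≤-refl q

open Machine

module Encoding where

  open import Data.Fin using (zero; suc)
  open import Data.List using (map; concatMap; tabulate; allFin)
  open import Data.List.Properties using (length-map; length-tabulate)
  open import Data.List.Relation.Unary.All using (All; []; _∷_; universal)
  open import Data.List.Relation.Unary.All.Properties using (concat⁺; map⁺)

  at-++ˡ : ∀ (A B : List ℕ) j → j < length A → at (A ++ B) j ≡ at A j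
  at-++ˡ (a ∷ A) B zero    _       = refl
  at-++ˡ (a ∷ A) B (suc j) (s≤s p) = at-++ˡ A B j p

  at-++ʳ : ∀ (A B : List ℕ) j → at (A ++ B) (length A + j) ≡ at B j
  at-++ʳ []      B j = refl
  at-++ʳ (a ∷ A) B j = at-++ʳ A B j

  at-concatMap : ∀ n m {X : Set} (h : Fin m → X) (g : X → List ℕ) → (∀ x → length (g x) ≡ n) →
                 ∀ (i : Fin m) j → j < n → at (concatMap g (tabulate h)) (toℕ i * n + j) ≡ at (g (h i)) j
  at-concatMap n (suc m) h g len zero j j<n =
    at-++ˡ (g (h zero)) _ j (subst (j <_) (sym (len _)) j<n)
  at-concatMap n (suc m) h g len (suc i) j j<n = begin
      at (g (h zero) ++ rest) (n + toℕ i * n + j)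
        ≡⟨ cong (at (g (h zero) ++ rest)) (trans (+-assoc n (toℕ i * n) j) (cong (_+ (toℕ i * n + j)) (sym (len (h zero))))) ⟩
      at (g (h zero) ++ rest) (length (g (h zero)) + (toℕ i * n + j))
        ≡⟨ at-++ʳ (g (h zero)) _ _ ⟩
      at rest (toℕ i * n + j)
        ≡⟨ at-concatMap n m (h ∘ suc) g len i j j<n ⟩
      at (g (h (suc i))) j ∎
    where
    open ≡-Reasoning
    rest = concatMap g (tabulate (h ∘ suc))

  at-map-tabulate : ∀ n {X : Set} (h : Fin n → X) (f : X → ℕ) (j : Fin n) → at (map f (tabulate h)) (toℕ j) ≡ f (h j)
  at-map-tabulate (suc n) h f zero    = refl
  at-map-tabulate (suc n) h f (suc j) = at-map-tabulate n (h ∘ suc) f j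

  encode-entry : ∀ {m n} (M : BoolMatrix m n) (i : Fin m) (j : Fin n) →
                 encode M (2 + (toℕ i * n + toℕ j)) ≡ bit (M i j)
  encode-entry {m} {n} M i j = trans
    (at-concatMap n m id (λ i → map (λ j → bit (M i j)) (allFin n))
       (λ _ → trans (length-map _ (allFin n)) (length-tabulate id)) i (toℕ j) (toℕ<n j))
    (at-map-tabulate n id (λ j → bit (M i j)) j)

  IsBit : ℕ → Set
  IsBit v = Σ Bool λ b → v ≡ bit b

  at-IsBit : ∀ (L : List ℕ) → All IsBit L → ∀ k → IsBit (at L k)
  at-IsBit []      _        k       = false , refl
  at-IsBit (x ∷ L) (px ∷ _) zero    = px
  at-IsBit (x ∷ L) (_ ∷ pL) (suc k) = at-IsBit L pL k

  encode-IsBit : ∀ {m n} (M : BoolMatrix m n) t → IsBit (encode M (2 + t))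
  encode-IsBit {m} {n} M = at-IsBit _ (concat⁺ (map⁺ (universal (λ i → map⁺ (universal (λ j → M i j , refl) (allFin n))) (allFin m))))

open Encoding

-- The matrix is given by its entries A i j for i < m, j < n; an Alive map marks the columns not yet removed.
module Peeling (m n : ℕ) (A : ℕ → ℕ → Bool) where

  Alive : Set
  Alive = ℕ → Bool

  hit : Alive → ℕ → ℕ → Bool
  hit al i j = A i j ∧ al j

  hitCount : Alive → ℕ → ℕ → ℕ
  hitCount al i zero    = 0
  hitCount al i (suc j) = if hit al i j then suc (hitCount al i j) else hitCount al i j

  lastHit : Alive → ℕ → ℕ → ℕ
  lastHit al i zero    = 0
  lastHit al i (suc j) = if hit al i j then j else lastHit al i j

  hitCount-hit : ∀ al i j → hit al i j ≡ true → hitCount al i (suc j) ≡ suc (hitCount al i j)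
  hitCount-hit al i j e rewrite e = refl

  hitCount-miss : ∀ al i j → hit al i j ≡ false → hitCount al i (suc j) ≡ hitCount al i j
  hitCount-miss al i j e rewrite e = refl

  lastHit-hit : ∀ al i j → hit al i j ≡ true → lastHit al i (suc j) ≡ j
  lastHit-hit al i j e rewrite e = refl

  lastHit-miss : ∀ al i j → hit al i j ≡ false → lastHit al i (suc j) ≡ lastHit al i j
  lastHit-miss al i j e rewrite e = refl

  kill : ℕ → Alive → Alive
  kill l al x = if x ≡ᵇ l then false else al x

  rowStep : Alive → ℕ → Alive
  rowStep al i = if hitCount al i n ≡ᵇ 1 then kill (lastHit al i n) al else al

  sweepRows : Alive → ℕ → Alive
  sweepRows al zero    = al
  sweepRows al (suc i) = rowStep (sweepRows al i) i

  sweep : Alive → Alive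
  sweep al = sweepRows al m

  sweeps : ℕ → Alive → Alive
  sweeps zero    al = al
  sweeps (suc p) al = sweep (sweeps p al)

  allAlive : Alive
  allAlive _ = true

  survivors : Alive
  survivors = sweeps n allAlive

  AllDead : Alive → Set
  AllDead al = ∀ x → x < n → al x ≡ false

  hitCount≡0⇒noHit : ∀ al i j → hitCount al i j ≡ 0 → ∀ x → x < j → hit al i x ≡ false
  hitCount≡0⇒noHit al i (suc j) e x x<sj with hit al i j in h
  hitCount≡0⇒noHit al i (suc j) () x x<sj | true
  ... | false with m<1+n⇒m<n∨m≡n x<sj
  ... | inj₁ x<j  = hitCount≡0⇒noHit al i j e x x<j
  ... | inj₂ refl = h

  noHit⇒hitCount≡0 : ∀ al i j → (∀ x → x < j → hit al i x ≡ false) → hitCount al i j ≡ 0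
  noHit⇒hitCount≡0 al i zero    h = refl
  noHit⇒hitCount≡0 al i (suc j) h with hit al i j in e
  ... | true  = case trans (sym e) (h j ≤-refl) of λ ()
  ... | false = noHit⇒hitCount≡0 al i j (λ x x<j → h x (m<n⇒m<1+n x<j))

  record UniqueHit (al : Alive) (i j l : ℕ) : Set where
    field
      l<j  : l < j
      hits : hit al i l ≡ true
      only : ∀ x → x < j → hit al i x ≡ true → x ≡ l

  hitCount≡1⇒UniqueHit : ∀ al i j → hitCount al i j ≡ 1 → UniqueHit al i j (lastHit al i j)
  hitCount≡1⇒UniqueHit al i (suc j) e with hit al i j in h
  ... | true = record { l<j = ≤-refl ; hits = h ; only = only }
    where
    only : ∀ x → x < suc j → hit al i x ≡ true → x ≡ j
    only x x<sj hx with m<1+n⇒m<n∨m≡n x<sj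
    ... | inj₂ x≡j = x≡j
    ... | inj₁ x<j = case trans (sym hx) (hitCount≡0⇒noHit al i j (suc-injective e) x x<j) of λ ()
  ... | false = record { l<j = m<n⇒m<1+n l<j ; hits = hits ; only = only′ }
    where
    open UniqueHit (hitCount≡1⇒UniqueHit al i j e)
    only′ : ∀ x → x < suc j → hit al i x ≡ true → x ≡ lastHit al i j
    only′ x x<sj hx with m<1+n⇒m<n∨m≡n x<sj
    ... | inj₁ x<j  = only x x<j hx
    ... | inj₂ refl = case trans (sym hx) h of λ ()

  UniqueHit⇒hitCount≡1 : ∀ {al i j l} → UniqueHit al i j l → hitCount al i j ≡ 1
  UniqueHit⇒hitCount≡1 {al} {i} {suc j} {l} u with hit al i j in e
  ... | true = cong suc (noHit⇒hitCount≡0 al i j noHit)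
    where
    noHit : ∀ x → x < j → hit al i x ≡ false
    noHit x x<j with hit al i x in hx
    ... | false = refl
    ... | true  = ⊥-elim (<⇒≢ x<j (trans (UniqueHit.only u x (m<n⇒m<1+n x<j) hx) (sym (UniqueHit.only u j ≤-refl e))))
  ... | false with m<1+n⇒m<n∨m≡n (UniqueHit.l<j u)
  ... | inj₁ l<j  = UniqueHit⇒hitCount≡1 (record { l<j = l<j ; hits = UniqueHit.hits u
                                                 ; only = λ x x<j → UniqueHit.only u x (m<n⇒m<1+n x<j) })
  ... | inj₂ refl = case trans (sym (UniqueHit.hits u)) e of λ ()

  -- Only the columns below n matter.
  _≈_ : Alive → Alive → Set
  al ≈ al' = ∀ x → x < n → al x ≡ al' x

  ≈-refl : ∀ {al} → al ≈ al
  ≈-refl x _ = refl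

  ≈-trans : ∀ {a b c} → a ≈ b → b ≈ c → a ≈ c
  ≈-trans p q x x<n = trans (p x x<n) (q x x<n)

  hitCount-cong : ∀ {al al'} → al ≈ al' → ∀ i j → j ≤ n → hitCount al i j ≡ hitCount al' i j
  hitCount-cong eq i zero    _    = refl
  hitCount-cong eq i (suc j) sj≤n
    rewrite eq j sj≤n | hitCount-cong eq i j (<⇒≤ sj≤n) = refl

  -- The termination measure.
  aliveCount : Alive → ℕ → ℕ
  aliveCount al zero    = 0
  aliveCount al (suc x) = if al x then suc (aliveCount al x) else aliveCount al x

  _⊆_ : Alive → Alive → Set
  al' ⊆ al = ∀ x → al' x ≡ true → al x ≡ true

  aliveCount-mono : ∀ {al al'} → al' ⊆ al → ∀ j → aliveCount al' j ≤ aliveCount al j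
  aliveCount-mono sb zero = z≤n
  aliveCount-mono {al} {al'} sb (suc j) with al' j in e' | al j in e
  ... | true  | true  = s≤s (aliveCount-mono sb j)
  ... | true  | false = case trans (sym (sb j e')) e of λ ()
  ... | false | true  = m≤n⇒m≤1+n (aliveCount-mono sb j)
  ... | false | false = aliveCount-mono sb j

  aliveCount-cong : ∀ {al al'} → al ≈ al' → ∀ j → j ≤ n → aliveCount al j ≡ aliveCount al' j
  aliveCount-cong eq zero    _    = refl
  aliveCount-cong eq (suc j) sj≤n rewrite eq j sj≤n | aliveCount-cong eq j (<⇒≤ sj≤n) = refl

  aliveCount≡suc⇒alive : ∀ al j k → aliveCount al j ≡ suc k → ∃ λ x → x < j × al x ≡ true
  aliveCount≡suc⇒alive al (suc j) k e with al j in aj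
  ... | true  = j , ≤-refl , aj
  ... | false with aliveCount≡suc⇒alive al j k e
  ... | x , x<j , ax = x , m<n⇒m<1+n x<j , ax

  aliveCount≡0⇒dead : ∀ al j → aliveCount al j ≡ 0 → ∀ x → x < j → al x ≡ false
  aliveCount≡0⇒dead al (suc j) e x x<sj with al j in aj
  aliveCount≡0⇒dead al (suc j) () x x<sj | true
  ... | false with m<1+n⇒m<n∨m≡n x<sj
  ... | inj₁ x<j  = aliveCount≡0⇒dead al j e x x<j
  ... | inj₂ refl = aj

  aliveCount-allAlive : ∀ j → aliveCount allAlive j ≡ j
  aliveCount-allAlive zero    = refl
  aliveCount-allAlive (suc j) = cong suc (aliveCount-allAlive j)

  kill-⊆ : ∀ l al → kill l al ⊆ al
  kill-⊆ l al x e with x ≡ᵇ l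
  kill-⊆ l al x () | true
  ... | false = e

  aliveCount-kill : ∀ al l j → al l ≡ true → l < j → aliveCount (kill l al) j < aliveCount al j
  aliveCount-kill al l (suc j) al-l l<sj with m<1+n⇒m<n∨m≡n l<sj
  ... | inj₂ refl rewrite ≡ᵇ-refl l | al-l = s≤s (aliveCount-mono (kill-⊆ l al) l)
  ... | inj₁ l<j with j ≡ᵇ l in jl
  ... | true  = ⊥-elim (<⇒≢ l<j (sym (≡ᵇ-true⇒≡ jl)))
  ... | false with al j
  ... | true  = s≤s (aliveCount-kill al l j al-l l<j)
  ... | false = aliveCount-kill al l j al-l l<j

  rowStep-⊆ : ∀ al i → rowStep al i ⊆ al
  rowStep-⊆ al i with hitCount al i n ≡ᵇ 1
  ... | true  = kill-⊆ _ al
  ... | false = λ x e → e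

  sweepRows-⊆ : ∀ al i → sweepRows al i ⊆ al
  sweepRows-⊆ al zero    x e = e
  sweepRows-⊆ al (suc i) x e = sweepRows-⊆ al i x (rowStep-⊆ (sweepRows al i) i x e)

  sweepRows-+ : ∀ al a d → sweepRows al (d + a) ⊆ sweepRows al a
  sweepRows-+ al a zero    x e = e
  sweepRows-+ al a (suc d) x e = sweepRows-+ al a d x (rowStep-⊆ (sweepRows al (d + a)) (d + a) x e)

  aliveCount-rowStep : ∀ al i → hitCount al i n ≡ 1 → aliveCount (rowStep al i) n < aliveCount al n
  aliveCount-rowStep al i c₁ rewrite c₁ =
    aliveCount-kill al (lastHit al i n) n (∧-conicalʳ _ _ hits) l<j
    where open UniqueHit (hitCount≡1⇒UniqueHit al i n c₁)

  rowStep-cases : ∀ al i → rowStep al i ≈ al ⊎ aliveCount (rowStep al i) n < aliveCount al n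
  rowStep-cases al i with hitCount al i n ≡ᵇ 1 in c
  ... | false = inj₁ ≈-refl
  ... | true with aliveCount-rowStep al i (≡ᵇ-true⇒≡ c)
  ... | r rewrite c = inj₂ r

  sweepRows-cases : ∀ al i → sweepRows al i ≈ al ⊎ aliveCount (sweepRows al i) n < aliveCount al n
  sweepRows-cases al zero = inj₁ ≈-refl
  sweepRows-cases al (suc i) with sweepRows-cases al i | rowStep-cases (sweepRows al i) i
  ... | inj₁ e₁ | inj₁ e₂ = inj₁ (≈-trans e₂ e₁)
  ... | inj₁ e₁ | inj₂ l₂ = inj₂ (subst (aliveCount (sweepRows al (suc i)) n <_) (aliveCount-cong e₁ n ≤-refl) l₂)
  ... | inj₂ l₁ | inj₁ e₂ = inj₂ (subst (_< aliveCount al n) (sym (aliveCount-cong e₂ n ≤-refl)) l₁)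
  ... | inj₂ l₁ | inj₂ l₂ = inj₂ (<-trans l₂ l₁)

  -- Either the first ρ rows already removed a column, or row ρ still has its single hit and removes one.
  aliveCount-sweep : ∀ al ρ → ρ < m → hitCount al ρ n ≡ 1 → aliveCount (sweep al) n < aliveCount al n
  aliveCount-sweep al ρ ρ<m c₁ = ≤-<-trans later through-ρ
    where
    through-ρ : aliveCount (sweepRows al (suc ρ)) n < aliveCount al n
    through-ρ with sweepRows-cases al ρ
    ... | inj₁ e = subst (aliveCount (sweepRows al (suc ρ)) n <_) (aliveCount-cong e n ≤-refl)
                     (aliveCount-rowStep (sweepRows al ρ) ρ (trans (hitCount-cong e ρ n ≤-refl) c₁))
    ... | inj₂ l = ≤-<-trans (aliveCount-mono (rowStep-⊆ (sweepRows al ρ) ρ) n) l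
    later : aliveCount (sweep al) n ≤ aliveCount (sweepRows al (suc ρ)) n
    later = aliveCount-mono (subst (λ z → sweepRows al z ⊆ sweepRows al (suc ρ)) (m∸n+n≡m ρ<m)
                                   (sweepRows-+ al (suc ρ) (m ∸ suc ρ))) n

  -- If every nonempty alive set has a row with a single hit, each sweep removes a column.
  AlwaysPeelable : Set
  AlwaysPeelable = ∀ al → (∃ λ x → x < n × al x ≡ true) → ∃ λ ρ → ρ < m × hitCount al ρ n ≡ 1

  aliveCount-sweeps : AlwaysPeelable → ∀ p → aliveCount (sweeps p allAlive) n ≤ n ∸ p
  aliveCount-sweeps H zero = ≤-reflexive (aliveCount-allAlive n)
  aliveCount-sweeps H (suc p) with aliveCount (sweeps p allAlive) n in e | aliveCount-sweeps H p
  ... | zero  | _ = ≤-trans (aliveCount-mono (sweepRows-⊆ (sweeps p allAlive) m) n) (≤-trans (≤-reflexive e) z≤n)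
  ... | suc c | c<n∸p with H (sweeps p allAlive) (aliveCount≡suc⇒alive (sweeps p allAlive) n c e)
  ... | ρ , ρ<m , c₁ =
    ≤-trans (≤-pred (subst (aliveCount (sweep (sweeps p allAlive)) n <_) e (aliveCount-sweep (sweeps p allAlive) ρ ρ<m c₁)))
            (subst (c ≤_) (pred[m∸n]≡m∸[1+n] n p) (<⇒≤pred c<n∸p))

  survivors-dead : AlwaysPeelable → AllDead survivors
  survivors-dead H = aliveCount≡0⇒dead survivors n (n≤0⇒n≡0 (subst (aliveCount survivors n ≤_) (n∸n≡0 n) (aliveCount-sweeps H n)))

  -- The columns removed so far are col 0, …, col (k ∸ 1), col t removed by row t.  Each such row has
  -- its hit in its own column and zeros in all later and all alive columns.
  record Peeled (al : Alive) : Set where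
    field
      k             : ℕ
      row col       : ℕ → ℕ
      row<m         : ∀ t → t < k → row t < m
      col<n         : ∀ t → t < k → col t < n
      diag          : ∀ t → t < k → A (row t) (col t) ≡ true
      upper         : ∀ t u → t < u → u < k → A (row t) (col u) ≡ false
      zero-on-alive : ∀ t → t < k → ∀ x → x < n → al x ≡ true → A (row t) x ≡ false
      dead-peeled   : ∀ x → x < n → al x ≡ false → ∃ λ t → t < k × col t ≡ x

  peeled-allAlive : Peeled allAlive
  peeled-allAlive = record
    { k = 0 ; row = λ _ → 0 ; col = λ _ → 0 ; row<m = λ _ () ; col<n = λ _ () ; diag = λ _ ()
    ; upper = λ _ _ _ () ; zero-on-alive = λ _ () ; dead-peeled = λ _ _ () }

  override : (ℕ → ℕ) → ℕ → ℕ → ℕ → ℕ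
  override f k v t = if t ≡ᵇ k then v else f t

  override-at : ∀ f k v → override f k v k ≡ v
  override-at f k v rewrite ≡ᵇ-refl k = refl

  override-below : ∀ f k v t → t < k → override f k v t ≡ f t
  override-below f k v t t<k with t ≡ᵇ k in e
  ... | false = refl
  ... | true  = ⊥-elim (<⇒≢ t<k (≡ᵇ-true⇒≡ e))

  kill-alive : ∀ {l al x} → kill l al x ≡ true → x ≢ l × al x ≡ true
  kill-alive {l} {al} {x} e with x ≡ᵇ l in xl
  kill-alive () | true
  ... | false = ≡ᵇ-false⇒≢ xl , e

  peeled-kill : ∀ {al i l} → Peeled al → i < m → UniqueHit al i n l → Peeled (kill l al)
  peeled-kill {al} {i} {l} p i<m u = record
    { k = suc k ; row = row′ ; col = col′ ; row<m = row′<m ; col<n = col′<n ; diag = diag′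
    ; upper = upper′ ; zero-on-alive = zero-on-alive′ ; dead-peeled = dead-peeled′ }
    where
    open Peeled p
    open UniqueHit u
    row′ col′ : ℕ → ℕ
    row′ = override row k i
    col′ = override col k l

    row′<m : ∀ t → t < suc k → row′ t < m
    row′<m t t<sk with m<1+n⇒m<n∨m≡n t<sk
    ... | inj₁ t<k rewrite override-below row k i t t<k = row<m t t<k
    ... | inj₂ refl rewrite override-at row k i = i<m

    col′<n : ∀ t → t < suc k → col′ t < n
    col′<n t t<sk with m<1+n⇒m<n∨m≡n t<sk
    ... | inj₁ t<k rewrite override-below col k l t t<k = col<n t t<k
    ... | inj₂ refl rewrite override-at col k l = l<j

    diag′ : ∀ t → t < suc k → A (row′ t) (col′ t) ≡ true
    diag′ t t<sk with m<1+n⇒m<n∨m≡n t<sk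
    ... | inj₁ t<k rewrite override-below row k i t t<k | override-below col k l t t<k = diag t t<k
    ... | inj₂ refl rewrite override-at row k i | override-at col k l = ∧-conicalˡ _ _ hits

    upper′ : ∀ t v → t < v → v < suc k → A (row′ t) (col′ v) ≡ false
    upper′ t v t<v v<sk with m<1+n⇒m<n∨m≡n v<sk
    ... | inj₁ v<k rewrite override-below row k i t (<-trans t<v v<k) | override-below col k l v v<k = upper t v t<v v<k
    ... | inj₂ refl rewrite override-below row k i t t<v | override-at col k l =
      zero-on-alive t t<v l l<j (∧-conicalʳ _ _ hits)

    zero-on-alive′ : ∀ t → t < suc k → ∀ x → x < n → kill l al x ≡ true → A (row′ t) x ≡ false
    zero-on-alive′ t t<sk x x<n kx with kill-alive {l} {al} {x} kx | m<1+n⇒m<n∨m≡n t<sk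
    ... | _ , ax | inj₁ t<k rewrite override-below row k i t t<k = zero-on-alive t t<k x x<n ax
    ... | x≢l , ax | inj₂ refl rewrite override-at row k i with A i x in aix
    ... | false = refl
    ... | true  = ⊥-elim (x≢l (only x x<n (cong₂ _∧_ aix ax)))

    dead-peeled′ : ∀ x → x < n → kill l al x ≡ false → ∃ λ t → t < suc k × col′ t ≡ x
    dead-peeled′ x x<n kx with x ≡ᵇ l in xl
    ... | true  = k , ≤-refl , trans (override-at col k l) (sym (≡ᵇ-true⇒≡ xl))
    ... | false with dead-peeled x x<n kx
    ... | t , t<k , ct = t , m<n⇒m<1+n t<k , trans (override-below col k l t t<k) ct

  peeled-rowStep : ∀ {al} i → Peeled al → i < m → Peeled (rowStep al i)
  peeled-rowStep {al} i p i<m with hitCount al i n ≡ᵇ 1 in c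
  ... | false = p
  ... | true  = peeled-kill p i<m (hitCount≡1⇒UniqueHit al i n (≡ᵇ-true⇒≡ c))

  peeled-sweepRows : ∀ {al} i → Peeled al → i ≤ m → Peeled (sweepRows al i)
  peeled-sweepRows zero    p _    = p
  peeled-sweepRows (suc i) p si≤m = peeled-rowStep i (peeled-sweepRows i p (<⇒≤ si≤m)) si≤m

  peeled-sweeps : ∀ p → Peeled (sweeps p allAlive)
  peeled-sweeps zero    = peeled-allAlive
  peeled-sweeps (suc p) = peeled-sweepRows m (peeled-sweeps p) ≤-refl

<-distinct⇒injective : ∀ {k} (f : ℕ → ℕ) → (∀ {t u} → t < u → u < k → f t ≢ f u) →
                       ∀ {t u} → t < k → u < k → f t ≡ f u → t ≡ u
<-distinct⇒injective f distinct {t} {u} t<k u<k e with <-cmp t u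
... | tri< t<u _ _ = ⊥-elim (distinct t<u u<k e)
... | tri≈ _ t≡u _ = t≡u
... | tri> _ _ u<t = ⊥-elim (distinct u<t t<k (sym e))

does-true⇒ : ∀ {P : Set} (d : Dec P) → does d ≡ true → P
does-true⇒ (yes p) _ = p
does-true⇒ (no _)  ()

module Independence {m n : ℕ} (M : BoolMatrix m n) (A : ℕ → ℕ → Bool)
                    (A≡M : ∀ (i : Fin m) (j : Fin n) → A (toℕ i) (toℕ j) ≡ M i j) where

  open import Data.Vec using (tabulate)
  open import Data.Vec.Properties using (lookup∘tabulate; lookup⇒[]=; []=⇒lookup)
  open Peeling m n A

  peeled-independent : ∀ {al} → Peeled al → AllDead al → AllColumnsIndependent M
  peeled-independent {al} p dead = Y , record
    { k = k ; r = r ; c = c ; r-inj = r-inj ; c-inj = c-inj ; r-in = r-in ; c-in = λ _ → ∈⊤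
    ; r-onto = r-onto ; c-onto = λ x _ → c-onto x
    ; diag = λ t → trans (M-rc t t) (diag (toℕ t) (toℕ<n t))
    ; upper = λ s t s<t → trans (M-rc s t) (upper (toℕ s) (toℕ t) s<t (toℕ<n t)) }
    where
    open Peeled p
    r : Fin k → Fin m
    r t = fromℕ< (row<m (toℕ t) (toℕ<n t))
    c : Fin k → Fin n
    c t = fromℕ< (col<n (toℕ t) (toℕ<n t))

    M-rc : ∀ s t → M (r s) (c t) ≡ A (row (toℕ s)) (col (toℕ t))
    M-rc s t = trans (sym (A≡M (r s) (c t))) (cong₂ A (toℕ-fromℕ< _) (toℕ-fromℕ< _))

    rows-distinct : ∀ {t u} → t < u → u < k → row t ≢ row u
    rows-distinct {t} {u} t<u u<k e =
      case trans (sym (upper t u t<u u<k)) (trans (cong (λ z → A z (col u)) e) (diag u u<k)) of λ ()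

    cols-distinct : ∀ {t u} → t < u → u < k → col t ≢ col u
    cols-distinct {t} {u} t<u u<k e =
      case trans (sym (upper t u t<u u<k)) (trans (cong (A (row t)) (sym e)) (diag t (<-trans t<u u<k))) of λ ()

    r-inj : ∀ {s t} → r s ≡ r t → s ≡ t
    r-inj {s} {t} e = toℕ-injective (<-distinct⇒injective row rows-distinct (toℕ<n s) (toℕ<n t)
                        (trans (sym (toℕ-fromℕ< _)) (trans (cong toℕ e) (toℕ-fromℕ< _))))

    c-inj : ∀ {s t} → c s ≡ c t → s ≡ t
    c-inj {s} {t} e = toℕ-injective (<-distinct⇒injective col cols-distinct (toℕ<n s) (toℕ<n t)
                        (trans (sym (toℕ-fromℕ< _)) (trans (cong toℕ e) (toℕ-fromℕ< _))))

    isRow : Fin m → Bool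
    isRow y = does (any? (λ t → r t ≟ᶠ y))

    Y : Subset m
    Y = tabulate isRow

    r-in : ∀ t → r t ∈ Y
    r-in t = lookup⇒[]= (r t) Y (trans (lookup∘tabulate isRow (r t)) (dec-true (any? (λ s → r s ≟ᶠ r t)) (t , refl)))

    r-onto : ∀ y → y ∈ Y → ∃ λ t → r t ≡ y
    r-onto y y∈Y = does-true⇒ (any? (λ t → r t ≟ᶠ y)) (trans (sym (lookup∘tabulate isRow y)) ([]=⇒lookup y∈Y))

    c-onto : ∀ x → ∃ λ t → c t ≡ x
    c-onto x with dead-peeled (toℕ x) (toℕ<n x) (dead (toℕ x) (toℕ<n x))
    ... | t , t<k , ct = fromℕ< t<k , toℕ-injective (trans (toℕ-fromℕ< _) (trans (cong col (toℕ-fromℕ< t<k)) ct))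

  least-true : ∀ {k} (P : Fin k → Bool) (i : Fin k) → P i ≡ true →
               Σ (Fin k) λ j → P j ≡ true × (∀ j' → j' <ᶠ j → P j' ≡ false)
  least-true {suc k} P i pi with P Fin.zero in p₀
  ... | true = Fin.zero , p₀ , λ _ ()
  ... | false with i
  ... | Fin.zero = case trans (sym p₀) pi of λ ()
  ... | Fin.suc i' with least-true (P ∘ Fin.suc) i' pi
  ... | j , pj , below = Fin.suc j , pj , below′
    where
    below′ : ∀ j' → j' <ᶠ Fin.suc j → P j' ≡ false
    below′ Fin.zero     _        = p₀
    below′ (Fin.suc j') (s≤s lt) = below j' lt

  -- The alive column that comes first in the triangular order is the only alive 1 of its row.
  independent⇒AlwaysPeelable : AllColumnsIndependent M → AlwaysPeelable
  independent⇒AlwaysPeelable (_ , ns) al (x₀ , x₀<n , ax₀) =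
    toℕ (r i) , toℕ<n (r i) , UniqueHit⇒hitCount≡1 (record { l<j = toℕ<n (c i) ; hits = hits ; only = only })
    where
    open NonsingularOn ns
    aliveAt : Fin k → Bool
    aliveAt j = al (toℕ (c j))
    column : ∀ {x} → x < n → ∃ λ j → toℕ (c j) ≡ x
    column x<n with c-onto (fromℕ< x<n) ∈⊤
    ... | j , cj = j , trans (cong toℕ cj) (toℕ-fromℕ< x<n)
    least = least-true aliveAt (proj₁ (column x₀<n)) (trans (cong al (proj₂ (column x₀<n))) ax₀)
    i = proj₁ least
    hits : hit al (toℕ (r i)) (toℕ (c i)) ≡ true
    hits rewrite A≡M (r i) (c i) | diag i = proj₁ (proj₂ least)
    only : ∀ x → x < n → hit al (toℕ (r i)) x ≡ true → x ≡ toℕ (c i)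
    only x x<n hx with column x<n
    ... | j , refl with <-cmp (toℕ i) (toℕ j)
    ... | tri≈ _ e _ = cong (toℕ ∘ c) (sym (toℕ-injective e))
    ... | tri< i<j _ _ = case trans (sym (∧-conicalˡ _ _ hx)) (trans (A≡M (r i) (c j)) (upper i j i<j)) of λ ()
    ... | tri> _ _ j<i = case trans (sym (∧-conicalʳ _ _ hx)) (proj₂ (proj₂ least) j j<i) of λ ()

module Cost where

  open import Data.Nat.Tactic.RingSolver using (solve-∀)

  rowCost : ℕ → ℕ
  rowCost n = 5 + (n * 11 + 1) + 6

  sweepCost : ℕ → ℕ → ℕ
  sweepCost m n = 3 + (m * rowCost n + 1) + 2

  mainCost : ℕ → ℕ → ℕ
  mainCost m n = (4 + (n * 5 + 1) + 2 + (n * sweepCost m n + 1)) + (2 + (n * 6 + 1))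

  leafCost : ℕ → ℕ
  leafCost m = 4 + ((m * 4 + 1) + 25)

  copyCost : ℕ → ℕ → ℕ
  copyCost m n = 6 + ((m * n ∸ 6) * 7 + 1)

  prefixCost : ℕ → ℕ → ℕ
  prefixCost m n = 2 + 6 + leafCost m + copyCost m n

  totalCost : ℕ → ℕ → ℕ
  totalCost m n = prefixCost m n + mainCost m n + 1

  -- totalCost with m * n ∸ 6 replaced by m * n, unfolded for the solver.
  totalCost-expanded : ∀ m n →
    2 + 6 + (4 + ((m * 4 + 1) + 25)) + (6 + ((m * n) * 7 + 1)) +
    ((4 + (n * 5 + 1) + 2 + (n * (3 + (m * (5 + (n * 11 + 1) + 6) + 1) + 2) + 1)) + (2 + (n * 6 + 1))) + 1
    ≡ 57 + 4 * m + 17 * n + 19 * (n * m) + 11 * (n * n * m)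
  totalCost-expanded = solve-∀

  totalCost≤polynomial : ∀ m n → totalCost m n ≤ 57 + 4 * m + 17 * n + 19 * (n * m) + 11 * (n * n * m)
  totalCost≤polynomial m n = ≤-trans
    (+-monoˡ-≤ 1 (+-monoˡ-≤ (mainCost m n) (+-monoʳ-≤ (2 + 6 + leafCost m)
      (+-monoʳ-≤ 6 (+-monoˡ-≤ 1 (*-monoˡ-≤ 7 (m∸n≤m (m * n) 6)))))))
    (≤-reflexive (totalCost-expanded m n))

  1+n≤2*n! : ∀ n → suc n ≤ 2 * n !
  1+n≤2*n! zero    = s≤s z≤n
  1+n≤2*n! (suc n) = begin
    2 + n                   ≤⟨ +-monoʳ-≤ 2 (m≤m+n n (n + 0)) ⟩
    2 * 1 + 2 * n           ≤⟨ +-mono-≤ (*-monoʳ-≤ 2 (1≤n! n)) (*-monoʳ-≤ 2 n≤n*n!) ⟩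
    2 * n ! + 2 * (n * n !) ≡⟨ sym (*-distribˡ-+ 2 (n !) (n * n !)) ⟩
    2 * (suc n * n !)       ∎
    where
    open ≤-Reasoning
    n≤n*n! : n ≤ n * n !
    n≤n*n! = subst (_≤ n * n !) (*-identityʳ n) (*-monoʳ-≤ n (1≤n! n))

  n*n≤2*n! : ∀ n → n * n ≤ 2 * n !
  n*n≤2*n! zero    = z≤n
  n*n≤2*n! (suc n) = begin
    suc n * suc n       ≤⟨ *-monoʳ-≤ (suc n) (1+n≤2*n! n) ⟩
    suc n * (2 * n !)   ≡⟨ distrib (suc n) (n !) ⟩
    2 * (suc n * n !)   ∎
    where
    open ≤-Reasoning
    distrib : ∀ a f → a * (2 * f) ≡ 2 * (a * f)
    distrib = solve-∀

  -- Each monomial of the polynomial is at most X = n² m once m, n ≥ 1.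
  totalCost≤ : ∀ a b → totalCost (suc a) (suc b) ≤ 216 * (suc b ! * suc a + 1)
  totalCost≤ a b = begin
    totalCost m n
      ≤⟨ totalCost≤polynomial m n ⟩
    57 + 4 * m + 17 * n + 19 * (n * m) + 11 * X
      ≤⟨ +-mono-≤ (+-mono-≤ (+-mono-≤ (+-mono-≤ (*-monoʳ-≤ 57 1≤X) (*-monoʳ-≤ 4 m≤X)) (*-monoʳ-≤ 17 n≤X))
                   (*-monoʳ-≤ 19 nm≤X)) ≤-refl ⟩
    57 * X + 4 * X + 17 * X + 19 * X + 11 * X
      ≡⟨ collect X ⟩
    108 * X
      ≤⟨ *-monoʳ-≤ 108 (*-monoˡ-≤ m (n*n≤2*n! n)) ⟩
    108 * (2 * n ! * m)
      ≡⟨ double (n !) m ⟩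
    216 * (n ! * m)
      ≤⟨ *-monoʳ-≤ 216 (m≤m+n (n ! * m) 1) ⟩
    216 * (n ! * m + 1) ∎
    where
    open ≤-Reasoning
    m = suc a
    n = suc b
    X = n * n * m
    collect : ∀ X → 57 * X + 4 * X + 17 * X + 19 * X + 11 * X ≡ 108 * X
    collect = solve-∀
    double : ∀ f q → 108 * (2 * f * q) ≡ 216 * (f * q)
    double = solve-∀
    1≤n : 1 ≤ n
    1≤n = s≤s z≤n
    1≤m : 1 ≤ m
    1≤m = s≤s z≤n
    nm≤X : n * m ≤ X
    nm≤X = subst (_≤ X) (*-identityˡ (n * m)) (subst (1 * (n * m) ≤_) (sym (*-assoc n n m)) (*-monoˡ-≤ (n * m) 1≤n))
    n≤nm : n ≤ n * m
    n≤nm = subst (_≤ n * m) (*-identityʳ n) (*-monoʳ-≤ n 1≤m)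
    m≤nm : m ≤ n * m
    m≤nm = subst (_≤ n * m) (*-identityˡ m) (*-monoˡ-≤ m 1≤n)
    m≤X : m ≤ X
    m≤X = ≤-trans m≤nm nm≤X
    n≤X : n ≤ X
    n≤X = ≤-trans n≤nm nm≤X
    1≤X : 1 ≤ X
    1≤X = ≤-trans 1≤n n≤X

open Cost

module Code where

  -- Registers: 0 = m, 1 = n, 2 = 1, 3 = base (alive flag of column j at base + j), 8 = base + n
  -- (entry (i, j) at base + n + i n + j), 9, 10, 11 = sweeps, rows, columns still to go, 12 = entry
  -- pointer, 13 = flag pointer, 14 = hits in the current row, 15 = flag pointer of the last hit,
  -- 16 = scratch, 17 = 0.  Jump targets are offsets from pc.
  mainCode : ℕ → ℕ → ℕ → Program
  mainCode pc yesAt noAt =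
    const 2 1 ∷               -- 0
    const 17 0 ∷              -- 1
    add 13 3 17 ∷             -- 2
    add 11 1 17 ∷             -- 3
    jz 11 (9 + pc) ∷          -- 4   set all flags to 1
    store 13 2 ∷              -- 5
    add 13 13 2 ∷             -- 6
    sub 11 11 2 ∷             -- 7
    jmp (4 + pc) ∷            -- 8
    add 8 3 1 ∷               -- 9
    add 9 1 17 ∷              -- 10
    jz 9 (39 + pc) ∷          -- 11  sweep loop
    add 12 8 17 ∷             -- 12
    add 10 0 17 ∷             -- 13
    jz 10 (37 + pc) ∷         -- 14  row loop
    const 14 0 ∷              -- 15
    add 15 3 17 ∷             -- 16
    add 13 3 17 ∷             -- 17
    add 11 1 17 ∷             -- 18
    jz 11 (30 + pc) ∷         -- 19  column loop
    load 16 12 ∷              -- 20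
    jz 16 (26 + pc) ∷         -- 21
    load 16 13 ∷              -- 22
    jz 16 (26 + pc) ∷         -- 23
    add 14 14 2 ∷             -- 24
    add 15 13 17 ∷            -- 25
    add 12 12 2 ∷             -- 26
    add 13 13 2 ∷             -- 27
    sub 11 11 2 ∷             -- 28
    jmp (19 + pc) ∷           -- 29
    sub 16 14 2 ∷             -- 30  kill the hit if it is the only one
    jz 14 (35 + pc) ∷         -- 31
    jz 16 (34 + pc) ∷         -- 32
    jmp (35 + pc) ∷           -- 33
    store 15 17 ∷             -- 34
    sub 10 10 2 ∷             -- 35
    jmp (14 + pc) ∷           -- 36
    sub 9 9 2 ∷               -- 37
    jmp (11 + pc) ∷           -- 38
    add 13 3 17 ∷             -- 39
    add 11 1 17 ∷             -- 40
    jz 11 yesAt ∷             -- 41  are all flags 0?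
    load 16 13 ∷              -- 42
    jz 16 (45 + pc) ∷         -- 43
    jmp noAt ∷                -- 44
    add 13 13 2 ∷             -- 45
    sub 11 11 2 ∷             -- 46
    jmp (41 + pc) ∷           -- 47
    []

  -- Copies entries 6, 7, … (cells 8, 9, …) to base + n + 6, …; entries 0 to 5 were placed by the leaf.
  copyCode : ℕ → Program
  copyCode C =
    const 2 28 ∷ sub 5 3 2 ∷ const 2 1 ∷ const 6 8 ∷ const 7 6 ∷ add 4 4 7 ∷
    jz 5 (13 + C) ∷ load 7 6 ∷ store 4 7 ∷ add 6 6 2 ∷ add 4 4 2 ∷ sub 5 5 2 ∷ jmp (6 + C) ∷ []

  save : ℕ → ℕ → Program
  save k s = const 2 k ∷ add 2 4 2 ∷ store 2 s ∷ []

  -- Reached with entries 0, 1, 2 equal to b₀, b₁, b₂: computes base = m n + 22 in cell 3 and base + n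
  -- in cell 4, and stores entries 0 to 5 at base + n, …, base + n + 5 (entries 3 to 5 first, since
  -- their cells 5 to 7 are then reused).
  leafCode : ℕ → ℕ → Bool → Bool → Bool → Program
  leafCode L C b₀ b₁ b₂ =
    const 2 1 ∷ const 3 2 ∷ const 4 0 ∷ add 4 4 0 ∷
    jz 4 (8 + L) ∷ add 3 3 1 ∷ sub 4 4 2 ∷ jmp (4 + L) ∷
    const 4 20 ∷ add 3 3 4 ∷ add 4 3 1 ∷
    save 3 5 ++ save 4 6 ++ save 5 7 ++
    const 5 (bit b₀) ∷ const 6 (bit b₁) ∷ const 7 (bit b₂) ∷
    save 0 5 ++ save 1 6 ++ save 2 7 ++
    jmp C ∷ []

  leafPos : Bool → Bool → Bool → ℕ
  leafPos false false false = 16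
  leafPos false false true  = 49
  leafPos false true  false = 82
  leafPos false true  true  = 115
  leafPos true  false false = 148
  leafPos true  false true  = 181
  leafPos true  true  false = 214
  leafPos true  true  true  = 247

  copyPos mainPos tailPos yesPos noPos : ℕ
  copyPos = 280
  mainPos = 293
  tailPos = 341
  yesPos  = 343
  noPos   = 345

  leaf : Bool → Bool → Bool → Program
  leaf b₀ b₁ b₂ = leafCode (leafPos b₀ b₁ b₂) copyPos b₀ b₁ b₂

  prefixCode : Program
  prefixCode = jz 0 tailPos ∷ jz 1 yesPos ∷ []

  treeCode : Program
  treeCode =
    jz 2 4 ∷ jmp 6 ∷ jz 3 8 ∷ jmp 10 ∷ jz 3 12 ∷ jmp 14 ∷
    jz 4 (leafPos false false false) ∷ jmp (leafPos false false true) ∷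
    jz 4 (leafPos false true false)  ∷ jmp (leafPos false true true) ∷
    jz 4 (leafPos true false false)  ∷ jmp (leafPos true false true) ∷
    jz 4 (leafPos true true false)   ∷ jmp (leafPos true true true) ∷ []

  tailCode : Program
  tailCode = jz 1 yesPos ∷ jmp noPos ∷ const 0 1 ∷ halt ∷ const 0 0 ∷ halt ∷ []

  program : Program
  program =
    prefixCode ++ treeCode ++
    leaf false false false ++ leaf false false true ++ leaf false true false ++ leaf false true true ++
    leaf true false false  ++ leaf true false true  ++ leaf true true false  ++ leaf true true true ++
    copyCode copyPos ++ mainCode mainPos yesPos noPos ++ tailCode

  leafAt : ∀ b₀ b₁ b₂ → CodeAt program (leafPos b₀ b₁ b₂) (leaf b₀ b₁ b₂)
  leafAt false false false = codeAt-drop program _ (leaf false false false) refl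
  leafAt false false true  = codeAt-drop program _ (leaf false false true) refl
  leafAt false true  false = codeAt-drop program _ (leaf false true false) refl
  leafAt false true  true  = codeAt-drop program _ (leaf false true true) refl
  leafAt true  false false = codeAt-drop program _ (leaf true false false) refl
  leafAt true  false true  = codeAt-drop program _ (leaf true false true) refl
  leafAt true  true  false = codeAt-drop program _ (leaf true true false) refl
  leafAt true  true  true  = codeAt-drop program _ (leaf true true true) refl

  copyAt : CodeAt program copyPos (copyCode copyPos)
  copyAt = codeAt-drop program copyPos (copyCode copyPos) refl

  mainAt : CodeAt program mainPos (mainCode mainPos yesPos noPos)
  mainAt = codeAt-drop program mainPos (mainCode mainPos yesPos noPos) refl

open Code

m+n+1≡m+[1+n] : ∀ a b → a + b + 1 ≡ a + suc b
m+n+1≡m+[1+n] a b = trans (+-assoc a b 1) (cong (a +_) (+-comm b 1))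

+-suc≡⇒< : ∀ {j r k} → j + suc r ≡ k → j < k
+-suc≡⇒< {j} e = subst (j <_) e (m<m+n j (s≤s z≤n))

-- The working memory: cells below 22 are registers, the alive flags start at base, and the copy
-- of the matrix at base + n.
module Layout {m n : ℕ} (M : BoolMatrix m n) where

  enc : Memory
  enc = encode M

  nonzero : ℕ → Bool
  nonzero zero    = false
  nonzero (suc _) = true

  entry : ℕ → ℕ → Bool
  entry i j = nonzero (enc (2 + (i * n + j)))

  entry≡M : ∀ (i : Fin m) (j : Fin n) → entry (toℕ i) (toℕ j) ≡ M i j
  entry≡M i j = trans (cong nonzero (encode-entry M i j)) (nonzero-bit (M i j))
    where
    nonzero-bit : ∀ b → nonzero (bit b) ≡ b
    nonzero-bit true  = refl
    nonzero-bit false = refl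

  base : ℕ
  base = m * n + 2 + 20

  22≤base : 22 ≤ base
  22≤base = +-monoˡ-≤ 20 (m≤n+m 2 (m * n))

  base≤ : ∀ a → base ≤ base + a
  base≤ a = m≤m+n base a

  below-base : ∀ {d x} → d < 22 → base ≤ x → d < x
  below-base d<22 base≤x = <-≤-trans d<22 (≤-trans 22≤base base≤x)

  register-below-base : ∀ {x} d → T (d <ᵇ 22) → base ≤ x → d < x
  register-below-base d p = below-base (<ᵇ⇒< d 22 p)

  -- State after a leaf: entries 0 to 5 are in place and the input from cell 8 on is intact.
  record Prepared (mem : Memory) : Set where
    field
      cell0  : mem 0 ≡ m
      cell1  : mem 1 ≡ n
      cell3  : mem 3 ≡ base
      cell4  : mem 4 ≡ base + n
      input  : ∀ x → 8 ≤ x → x < base → mem x ≡ enc x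
      copied : ∀ t → t < 6 → mem (base + n + t) ≡ enc (2 + t)

  record Copied (mem : Memory) : Set where
    field
      cell0  : mem 0 ≡ m
      cell1  : mem 1 ≡ n
      cell3  : mem 3 ≡ base
      matrix : ∀ t → t < m * n → mem (base + n + t) ≡ enc (2 + t)
module MainProof (m n : ℕ) (M : BoolMatrix m n)
                 {P : Program} {pc yesP noP : ℕ} (ca : CodeAt P pc (mainCode pc yesP noP)) where

  open Layout M

  open Peeling m n entry

  record Inv (al : Alive) (mem : Memory) : Set where
    field
      i0 : mem 0 ≡ m
      i1 : mem 1 ≡ n
      i2 : mem 2 ≡ 1
      i3 : mem 3 ≡ base
      i8 : mem 8 ≡ base + n
      i17 : mem 17 ≡ 0
      matrix : ∀ t → t < m * n → mem (base + n + t) ≡ enc (2 + t)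
      flags : ∀ j → j < n → mem (base + j) ≡ bit (al j)

  inv-update : ∀ {al mem} d v → 8 < d → d < 17 → Inv al mem → Inv al (update mem d v)
  inv-update {al} {mem} d v 8<d d<17 I = record
    { i0 = trans (update-below mem d v 0 (<-trans (<ᵇ⇒< 0 8 tt) 8<d)) i0
    ; i1 = trans (update-below mem d v 1 (<-trans (<ᵇ⇒< 1 8 tt) 8<d)) i1
    ; i2 = trans (update-below mem d v 2 (<-trans (<ᵇ⇒< 2 8 tt) 8<d)) i2
    ; i3 = trans (update-below mem d v 3 (<-trans (<ᵇ⇒< 3 8 tt) 8<d)) i3
    ; i8 = trans (update-below mem d v 8 8<d) i8
    ; i17 = trans (update-above mem d v 17 d<17) i17
    ; matrix = λ t t< → trans (update-above mem d v _ (below-base (<-trans d<17 (<ᵇ⇒< 17 22 tt)) (≤-trans (base≤ n) (m≤m+n (base + n) t)))) (matrix t t<)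
    ; flags = λ j j< → trans (update-above mem d v _ (below-base (<-trans d<17 (<ᵇ⇒< 17 22 tt)) (base≤ j))) (flags j j<)
    }
    where open Inv I

  scratch-update : ∀ {al mem} d v → {T (8 <ᵇ d)} → {T (d <ᵇ 17)} → Inv al mem → Inv al (update mem d v)
  scratch-update d v {p} {q} I = inv-update d v (<ᵇ⇒< 8 d p) (<ᵇ⇒< d 17 q) I

  record ColumnState (al : Alive) (i j : ℕ) (mem : Memory) : Set where
    field
      inv : Inv al mem
      c12 : mem 12 ≡ base + n + (i * n + j)
      c13 : mem 13 ≡ base + j
      c14 : mem 14 ≡ hitCount al i j
      c15 : mem 15 ≡ base + lastHit al i j

  ColumnDone : Alive → ℕ → ℕ → ℕ → Memory → Set
  ColumnDone al i v9 v10 mem' = ColumnState al i n mem' × mem' 9 ≡ v9 × mem' 10 ≡ v10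

  entry-index< : ∀ {i j} → i < m → j < n → i * n + j < m * n
  entry-index< {i} {j} i<m j<n = begin-strict
      i * n + j <⟨ +-monoʳ-< (i * n) j<n ⟩
      i * n + n ≡⟨ +-comm (i * n) n ⟩
      suc i * n ≤⟨ *-monoˡ-≤ n i<m ⟩
      m * n ∎
    where open ≤-Reasoning

  next-entry : ∀ i j → base + n + (i * n + j) + 1 ≡ base + n + (i * n + suc j)
  next-entry i j = trans (m+n+1≡m+[1+n] (base + n) (i * n + j)) (cong (base + n +_) (sym (+-suc (i * n) j)))

  bit-cases : ∀ v → IsBit v → (v ≡ 0 × nonzero v ≡ false) ⊎ (v ≡ 1 × nonzero v ≡ true)
  bit-cases v (false , e) rewrite e = inj₁ (refl , refl)
  bit-cases v (true , e) rewrite e = inj₂ (refl , refl)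

  columnStep : ∀ r j {al i mem} v9 v10 → i < m → j < n → ColumnState al i j mem → mem 11 ≡ suc r → mem 9 ≡ v9 → mem 10 ≡ v10 →
      Runs P (19 + pc) mem (19 + pc)
        (λ mem' → ColumnState al i (suc j) mem' × mem' 11 ≡ r × mem' 9 ≡ v9 × mem' 10 ≡ v10) 11
  columnStep r j {al} {i} {mem} v9 v10 i<m j<n st h11 h9 h10 with bit-cases (enc (2 + (i * n + j))) (encode-IsBit M (i * n + j))
  ... | inj₁ (e0 , nzf) = weaken (≤ᵇ⇒≤ 7 11 tt) (fromExec
          (step (ca 19 tt) tt (jz-suc 11 h11) (step (ca 20 tt) tt refl (step (ca 21 tt) tt (jz-zero 16 ev)
           (step (ca 26 tt) tt refl (step (ca 27 tt) tt refl (step (ca 28 tt) tt refl (step (ca 29 tt) tt refl done)))))))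
          post)
    where
    open ColumnState st
    ev : mem (mem 12) ≡ 0
    ev = trans (cong mem c12) (trans (Inv.matrix inv _ (entry-index< i<m j<n)) e0)
    hitf : hit al i j ≡ false
    hitf = cong (_∧ al j) nzf
    post = record
      { inv = scratch-update 11 _ (scratch-update 13 _ (scratch-update 12 _ (scratch-update 16 _ inv)))
      ; c12 = trans (cong₂ _+_ c12 (Inv.i2 inv)) (next-entry i j)
      ; c13 = trans (cong₂ _+_ c13 (Inv.i2 inv)) (m+n+1≡m+[1+n] base j)
      ; c14 = trans c14 (sym (hitCount-miss al i j hitf))
      ; c15 = trans c15 (sym (cong (base +_) (lastHit-miss al i j hitf)))
      } , cong₂ _∸_ h11 (Inv.i2 inv) , h9 , h10
  ... | inj₂ (e1 , nzt) with al j in alj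
  ... | false = weaken (≤ᵇ⇒≤ 9 11 tt) (fromExec
          (step (ca 19 tt) tt (jz-suc 11 h11) (step (ca 20 tt) tt refl (step (ca 21 tt) tt (jz-suc 16 ev)
           (step (ca 22 tt) tt refl (step (ca 23 tt) tt (jz-zero 16 ev2)
           (step (ca 26 tt) tt refl (step (ca 27 tt) tt refl (step (ca 28 tt) tt refl (step (ca 29 tt) tt refl done)))))))))
          post)
    where
    open ColumnState st
    ev : mem (mem 12) ≡ 1
    ev = trans (cong mem c12) (trans (Inv.matrix inv _ (entry-index< i<m j<n)) e1)
    ev2 : update mem 16 (mem (mem 12)) (mem 13) ≡ 0
    ev2 = trans (update-above mem 16 _ (mem 13) (subst (16 <_) (sym c13) (below-base (<ᵇ⇒< 16 22 tt) (base≤ j))))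
            (trans (cong mem c13) (trans (Inv.flags inv j j<n) (cong bit alj)))
    hitf : hit al i j ≡ false
    hitf = trans (cong₂ _∧_ nzt alj) refl
    post = record
      { inv = scratch-update 11 _ (scratch-update 13 _ (scratch-update 12 _ (scratch-update 16 _ (scratch-update 16 _ inv))))
      ; c12 = trans (cong₂ _+_ c12 (Inv.i2 inv)) (next-entry i j)
      ; c13 = trans (cong₂ _+_ c13 (Inv.i2 inv)) (m+n+1≡m+[1+n] base j)
      ; c14 = trans c14 (sym (hitCount-miss al i j hitf))
      ; c15 = trans c15 (sym (cong (base +_) (lastHit-miss al i j hitf)))
      } , cong₂ _∸_ h11 (Inv.i2 inv) , h9 , h10
  ... | true = weaken ≤-refl (fromExec
          (step (ca 19 tt) tt (jz-suc 11 h11) (step (ca 20 tt) tt refl (step (ca 21 tt) tt (jz-suc 16 ev)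
           (step (ca 22 tt) tt refl (step (ca 23 tt) tt (jz-suc 16 ev2)
           (step (ca 24 tt) tt refl (step (ca 25 tt) tt refl
           (step (ca 26 tt) tt refl (step (ca 27 tt) tt refl (step (ca 28 tt) tt refl (step (ca 29 tt) tt refl done)))))))))))
          post)
    where
    open ColumnState st
    ev : mem (mem 12) ≡ 1
    ev = trans (cong mem c12) (trans (Inv.matrix inv _ (entry-index< i<m j<n)) e1)
    ev2 : update mem 16 (mem (mem 12)) (mem 13) ≡ 1
    ev2 = trans (update-above mem 16 _ (mem 13) (subst (16 <_) (sym c13) (below-base (<ᵇ⇒< 16 22 tt) (base≤ j))))
            (trans (cong mem c13) (trans (Inv.flags inv j j<n) (cong bit alj)))
    hitt : hit al i j ≡ true
    hitt = trans (cong₂ _∧_ nzt alj) refl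
    post = record
      { inv = scratch-update 11 _ (scratch-update 13 _ (scratch-update 12 _ (scratch-update 15 _ (scratch-update 14 _ (scratch-update 16 _ (scratch-update 16 _ inv))))))
      ; c12 = trans (cong₂ _+_ c12 (Inv.i2 inv)) (next-entry i j)
      ; c13 = trans (cong₂ _+_ c13 (Inv.i2 inv)) (m+n+1≡m+[1+n] base j)
      ; c14 = trans (cong₂ _+_ c14 (Inv.i2 inv)) (trans (+-comm _ 1) (sym (hitCount-hit al i j hitt)))
      ; c15 = trans (cong₂ _+_ c13 (Inv.i17 inv)) (trans (+-identityʳ _) (sym (cong (base +_) (lastHit-hit al i j hitt))))
      } , cong₂ _∸_ h11 (Inv.i2 inv) , h9 , h10

  columnLoop : ∀ r j → j + r ≡ n → ∀ {al i mem} v9 v10 → i < m → ColumnState al i j mem → mem 11 ≡ r → mem 9 ≡ v9 → mem 10 ≡ v10 →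
      Runs P (19 + pc) mem (30 + pc) (ColumnDone al i v9 v10) (r * 11 + 1)
  columnLoop zero j e {al} {i} {mem} v9 v10 i<m st h11 h9 h10 =
    fromExec (step (ca 19 tt) tt (jz-zero 11 h11) done)
      (subst (λ z → ColumnState al i z mem) (trans (sym (+-identityʳ j)) e) st , h9 , h10)
  columnLoop (suc r) j e v9 v10 i<m st h11 h9 h10 =
    columnStep r j v9 v10 i<m j<n st h11 h9 h10 >>> λ m1 (st' , h11' , h9' , h10') →
    columnLoop r (suc j) (trans (sym (+-suc j r)) e) v9 v10 i<m st' h11' h9' h10'
    where
    j<n : j < n
    j<n = +-suc≡⇒< e

  inv-kill : ∀ {al mem} a v l → a ≡ base + l → v ≡ 0 → l < n → Inv al mem → Inv (kill l al) (update mem a v)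
  inv-kill {al} {mem} a v l ae v0 l<n I = record
    { i0 = trans (update-below mem a v 0 (low 0 tt)) i0
    ; i1 = trans (update-below mem a v 1 (low 1 tt)) i1
    ; i2 = trans (update-below mem a v 2 (low 2 tt)) i2
    ; i3 = trans (update-below mem a v 3 (low 3 tt)) i3
    ; i8 = trans (update-below mem a v 8 (low 8 tt)) i8
    ; i17 = trans (update-below mem a v 17 (low 17 tt)) i17
    ; matrix = λ t t< → trans (update-above mem a v _ (subst (_< base + n + t) (sym ae)
                        (<-≤-trans (+-monoʳ-< base l<n) (m≤m+n (base + n) t)))) (matrix t t<)
    ; flags = flags′
    }
    where
    open Inv I
    low : ∀ x → T (x <ᵇ 22) → x < a
    low x p = subst (x <_) (sym ae) (below-base (<ᵇ⇒< x 22 p) (base≤ l))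
    flags′ : ∀ j → j < n → update mem a v (base + j) ≡ bit (kill l al j)
    flags′ j j<n with j ≡ᵇ l in jl
    ... | true rewrite ≡ᵇ⇒≡ j l (subst T (sym jl) _) = trans (cong (update mem a v) (sym ae)) (trans (update-same mem a v) v0)
    ... | false = trans (update-other mem a v (base + j) (λ e → ≡ᵇ-false⇒≢ jl (+-cancelˡ-≡ base j l (trans e ae)))) (flags j j<n)

  RowDone : Alive → ℕ → ℕ → ℕ → Memory → Set
  RowDone al i v9 q mem' = Inv al mem' × mem' 9 ≡ v9 × mem' 10 ≡ q × mem' 12 ≡ base + n + i * n

  next-row : ∀ i → base + n + (i * n + n) ≡ base + n + suc i * n
  next-row i = cong (base + n +_) (+-comm (i * n) n)

  rowEnd : ∀ {al i mem} v9 q → i < m → ColumnState al i n mem → mem 9 ≡ v9 → mem 10 ≡ suc q →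
      Runs P (30 + pc) mem (14 + pc) (RowDone (rowStep al i) (suc i) v9 q) 6
  rowEnd {al} {i} {mem} v9 q i<m st h9 h10 with hitCount al i n in ce
  ... | zero = weaken (≤ᵇ⇒≤ 4 6 tt) (fromExec
          (step (ca 30 tt) tt refl (step (ca 31 tt) tt (jz-zero 14 (trans c14 ce))
           (step (ca 35 tt) tt refl (step (ca 36 tt) tt refl done))))
          (scratch-update 10 _ (scratch-update 16 _ inv) ,
           h9 , cong₂ _∸_ h10 (Inv.i2 inv) , trans c12 (next-row i)))
    where open ColumnState st
  ... | suc zero = weaken ≤-refl (fromExec
          (step (ca 30 tt) tt refl (step (ca 31 tt) tt (jz-suc 14 (trans c14 ce))
           (step (ca 32 tt) tt (jz-zero 16 (cong₂ _∸_ (trans c14 ce) (Inv.i2 inv)))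
           (step (ca 34 tt) tt refl
           (step (ca 35 tt) tt refl (step (ca 36 tt) tt refl done))))))
          (scratch-update 10 _ invK ,
           trans (update-below _ _ _ 9 (subst (9 <_) (sym c15') (below-base (<ᵇ⇒< 9 22 tt) (base≤ l)))) h9 ,
           cong₂ _∸_ (trans (update-below _ _ _ 10 (subst (10 <_) (sym c15') (below-base (<ᵇ⇒< 10 22 tt) (base≤ l)))) h10) (Inv.i2 invK) ,
           trans (update-below _ _ _ 12 (subst (12 <_) (sym c15') (below-base (<ᵇ⇒< 12 22 tt) (base≤ l)))) (trans c12 (next-row i))))
    where
    open ColumnState st
    l = lastHit al i n
    u = hitCount≡1⇒UniqueHit al i n ce
    c15' : update mem 16 (mem 14 ∸ mem 2) 15 ≡ base + l
    c15' = c15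
    invK = inv-kill _ _ l c15' (Inv.i17 inv) (UniqueHit.l<j u) (scratch-update 16 (mem 14 ∸ mem 2) inv)
  ... | suc (suc k) = weaken ≤-refl (fromExec
          (step (ca 30 tt) tt refl (step (ca 31 tt) tt (jz-suc 14 (trans c14 ce))
           (step (ca 32 tt) tt (jz-suc 16 (cong₂ _∸_ (trans c14 ce) (Inv.i2 inv)))
           (step (ca 33 tt) tt refl
           (step (ca 35 tt) tt refl (step (ca 36 tt) tt refl done))))))
          (scratch-update 10 _ (scratch-update 16 _ inv) ,
           h9 , cong₂ _∸_ h10 (Inv.i2 inv) , trans c12 (next-row i)))
    where open ColumnState st

  rowRun : ∀ {al i mem} v9 q → i < m → Inv al mem → mem 9 ≡ v9 → mem 10 ≡ suc q → mem 12 ≡ base + n + i * n →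
      Runs P (14 + pc) mem (14 + pc) (RowDone (rowStep al i) (suc i) v9 q) (rowCost n)
  rowRun {al} {i} {mem} v9 q i<m I h9 h10 h12 =
    fromExec {Q = λ mm → ColumnState al i 0 mm × mm 11 ≡ n × mm 9 ≡ v9 × mm 10 ≡ suc q} (step (ca 14 tt) tt (jz-suc 10 h10) (step (ca 15 tt) tt refl (step (ca 16 tt) tt refl
              (step (ca 17 tt) tt refl (step (ca 18 tt) tt refl done)))))
      (st0 , trans (cong₂ _+_ (Inv.i1 I) (Inv.i17 I)) (+-identityʳ n) , h9 , h10) >>> λ m1 (st , h11 , g9 , g10) →
    columnLoop n 0 refl v9 (suc q) i<m st h11 g9 g10 >>> λ m2 (st' , h9' , h10') →
    rowEnd v9 q i<m st' h9' h10'
    where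
    st0 = record
      { inv = scratch-update 11 _ (scratch-update 13 _ (scratch-update 15 _ (scratch-update 14 _ I)))
      ; c12 = trans h12 (cong (base + n +_) (sym (+-identityʳ (i * n))))
      ; c13 = cong₂ _+_ (Inv.i3 I) (Inv.i17 I)
      ; c14 = refl
      ; c15 = cong₂ _+_ (Inv.i3 I) (Inv.i17 I) }

  rowLoop : ∀ q i al0 {mem} v9 → i + q ≡ m → Inv (sweepRows al0 i) mem → mem 9 ≡ v9 → mem 10 ≡ q → mem 12 ≡ base + n + i * n →
      Runs P (14 + pc) mem (37 + pc) (λ mem' → Inv (sweep al0) mem' × mem' 9 ≡ v9) (q * (rowCost n) + 1)
  rowLoop zero i al0 {mem} v9 e I h9 h10 h12 =
    fromExec (step (ca 14 tt) tt (jz-zero 10 h10) done)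
      (subst (λ z → Inv (sweepRows al0 z) mem) (trans (sym (+-identityʳ i)) e) I , h9)
  rowLoop (suc q) i al0 v9 e I h9 h10 h12 =
    weaken (≤-reflexive (sym (+-assoc (rowCost n) (q * (rowCost n)) 1)))
    (rowRun v9 q i<m I h9 h10 h12 >>> λ m1 (I' , h9' , h10' , h12') →
     rowLoop q (suc i) al0 v9 (trans (sym (+-suc i q)) e) I' h9' h10' h12')
    where
    i<m : i < m
    i<m = +-suc≡⇒< e

  sweeps-sweep : ∀ p al → sweeps p (sweep al) ≡ sweeps (suc p) al
  sweeps-sweep zero al = refl
  sweeps-sweep (suc p) al = cong sweep (sweeps-sweep p al)

  sweepLoop : ∀ p {al mem} → Inv al mem → mem 9 ≡ p → Runs P (11 + pc) mem (39 + pc) (Inv (sweeps p al)) (p * (sweepCost m n) + 1)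
  sweepLoop zero {al} {mem} I h9 = fromExec (step (ca 11 tt) tt (jz-zero 9 h9) done) I
  sweepLoop (suc p) {al} {mem} I h9 =
    weaken (≤-reflexive (sym (+-assoc (sweepCost m n) (p * (sweepCost m n)) 1)))
    ((fromExec {Q = λ mm → Inv al mm × mm 9 ≡ suc p × mm 10 ≡ m × mm 12 ≡ base + n + 0 * n} (step (ca 11 tt) tt (jz-suc 9 h9) (step (ca 12 tt) tt refl (step (ca 13 tt) tt refl done)))
        (scratch-update 10 _ (scratch-update 12 _ I) , h9 , trans (cong₂ _+_ (Inv.i0 I) (Inv.i17 I)) (+-identityʳ m) ,
         cong₂ _+_ (Inv.i8 I) (Inv.i17 I)) >>> λ m1 (I1 , g9 , g10 , g12) →
      rowLoop m 0 al (suc p) refl I1 g9 g10 g12 >>> λ m2 (I2 , h9') →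
      fromExec {Q = λ mm → Inv (sweep al) mm × mm 9 ≡ p} (step (ca 37 tt) tt refl (step (ca 38 tt) tt refl done)) (scratch-update 9 _ I2 , cong₂ _∸_ h9' (Inv.i2 I2))) >>> λ m3 (I3 , h9'') →
     mapPost (λ mm z → subst (λ a → Inv a mm) (sweeps-sweep p al) z) (sweepLoop p I3 h9''))

  record InitState (j : ℕ) (mem : Memory) : Set where
    field
      q0 : mem 0 ≡ m
      q1 : mem 1 ≡ n
      q2 : mem 2 ≡ 1
      q3 : mem 3 ≡ base
      q17 : mem 17 ≡ 0
      qmat : ∀ t → t < m * n → mem (base + n + t) ≡ enc (2 + t)
      q13 : mem 13 ≡ base + j
      qal : ∀ x → x < j → mem (base + x) ≡ 1

  initLoop : ∀ r j {mem} → j + r ≡ n → InitState j mem → mem 11 ≡ r →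
      Runs P (4 + pc) mem (9 + pc) (InitState n) (r * 5 + 1)
  initLoop zero j {mem} e S h11 = fromExec (step (ca 4 tt) tt (jz-zero 11 h11) done) (subst (λ z → InitState z mem) (trans (sym (+-identityʳ j)) e) S)
  initLoop (suc r) j {mem} e S h11 =
    fromExec {Q = λ mm → InitState (suc j) mm × mm 11 ≡ r} (step (ca 4 tt) tt (jz-suc 11 h11) (step (ca 5 tt) tt refl (step (ca 6 tt) tt refl
              (step (ca 7 tt) tt refl (step (ca 8 tt) tt refl done))))) (S' , h11') >>> λ m1 (S1 , h) →
    initLoop r (suc j) (trans (sym (+-suc j r)) e) S1 h
    where
    open InitState S
    j<n : j < n
    j<n = +-suc≡⇒< e
    a = mem 13
    mS = update mem a (mem 2)
    low : ∀ x → T (x <ᵇ 22) → x < a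
    low x p = subst (x <_) (sym q13) (below-base (<ᵇ⇒< x 22 p) (base≤ j))
    u : ∀ x → T (x <ᵇ 22) → mS x ≡ mem x
    u x p = update-below mem a (mem 2) x (low x p)
    S' : InitState (suc j) (update (update mS 13 (mS 13 + mS 2)) 11 (mS 11 ∸ mS 2))
    S' = record
      { q0 = trans (u 0 tt) q0 ; q1 = trans (u 1 tt) q1 ; q2 = trans (u 2 tt) q2 ; q3 = trans (u 3 tt) q3
      ; q17 = trans (u 17 tt) q17
      ; qmat = λ t t< → trans (update-above _ 11 _ _ (below-base (<ᵇ⇒< 11 22 tt) (≤-trans (base≤ n) (m≤m+n (base + n) t))))
                        (trans (update-above _ 13 _ _ (below-base (<ᵇ⇒< 13 22 tt) (≤-trans (base≤ n) (m≤m+n (base + n) t))))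
                        (trans (update-above mem a _ _ (subst (_< base + n + t) (sym q13) (<-≤-trans (+-monoʳ-< base j<n) (m≤m+n (base + n) t))))
                        (qmat t t<)))
      ; q13 = trans (cong₂ _+_ (trans (u 13 tt) q13) (trans (u 2 tt) q2)) (m+n+1≡m+[1+n] base j)
      ; qal = λ x x<sj → trans (update-above _ 11 _ _ (below-base (<ᵇ⇒< 11 22 tt) (base≤ x))) (trans (update-above _ 13 _ _ (below-base (<ᵇ⇒< 13 22 tt) (base≤ x))) (qa x x<sj))
      }
      where
      qa : ∀ x → x < suc j → mS (base + x) ≡ 1
      qa x x<sj with m<1+n⇒m<n∨m≡n x<sj
      ... | inj₂ refl = trans (cong mS (sym q13)) (trans (update-same mem a (mem 2)) q2)
      ... | inj₁ x<j = trans (update-other mem a _ _ (λ eq → <-irrefl (+-cancelˡ-≡ base x j (trans eq q13)) x<j)) (qal x x<j)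
    h11' : update (update mS 13 (mS 13 + mS 2)) 11 (mS 11 ∸ mS 2) 11 ≡ r
    h11' = cong₂ _∸_ (trans (u 11 tt) h11) (trans (u 2 tt) q2)

  CheckResult : Alive → Memory → ℕ → Set
  CheckResult al mem B = Runs P (41 + pc) mem yesP (λ _ → AllDead al) B ⊎ Runs P (41 + pc) mem noP (λ _ → ∃ λ x → x < n × al x ≡ true) B

  checkLoop : ∀ r j al {mem} → j + r ≡ n → Inv al mem → mem 13 ≡ base + j → mem 11 ≡ r → (∀ x → x < j → al x ≡ false) →
      CheckResult al mem (r * 6 + 1)
  checkLoop zero j al {mem} e I h13 h11 dead = inj₁ (fromExec (step (ca 41 tt) tt (jz-zero 11 h11) done)
    (λ x x<n → dead x (subst (x <_) (sym (trans (sym (+-identityʳ j)) e)) x<n)))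
  checkLoop (suc r) j al {mem} e I h13 h11 dead with al j in alj
  ... | true = inj₂ (weaken (≤ᵇ⇒≤ 4 (suc r * 6 + 1) tt') (fromExec
        (step (ca 41 tt) tt (jz-suc 11 h11) (step (ca 42 tt) tt refl (step (ca 43 tt) tt (jz-suc 16 ev)
         (step (ca 44 tt) tt refl done))))
        (j , j<n , alj)))
    where
    j<n : j < n
    j<n = +-suc≡⇒< e
    ev : mem (mem 13) ≡ 1
    ev = trans (cong mem h13) (trans (Inv.flags I j j<n) (cong bit alj))
    tt' : T (4 ≤ᵇ (suc r * 6 + 1))
    tt' = <⇒<ᵇ {3} {suc r * 6 + 1} (s≤s (s≤s (s≤s (s≤s z≤n))))
  ... | false =
    fromExec {Q = λ mm → Inv al mm × mm 13 ≡ base + suc j × mm 11 ≡ r}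
      (step (ca 41 tt) tt (jz-suc 11 h11) (step (ca 42 tt) tt refl (step (ca 43 tt) tt (jz-zero 16 ev)
       (step (ca 45 tt) tt refl (step (ca 46 tt) tt refl (step (ca 47 tt) tt refl done))))))
      (scratch-update 11 _ (scratch-update 13 _ (scratch-update 16 _ I)) ,
       trans (cong₂ _+_ h13 (Inv.i2 I)) (m+n+1≡m+[1+n] base j) , cong₂ _∸_ h11 (Inv.i2 I))
    >>>⊎ λ m1 (I1 , g13 , g11) → checkLoop r (suc j) al (trans (sym (+-suc j r)) e) I1 g13 g11 dead'
    where
    j<n : j < n
    j<n = +-suc≡⇒< e
    ev : mem (mem 13) ≡ 0
    ev = trans (cong mem h13) (trans (Inv.flags I j j<n) (cong bit alj))
    dead' : ∀ x → x < suc j → al x ≡ false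
    dead' x x<sj with m<1+n⇒m<n∨m≡n x<sj
    ... | inj₁ x<j = dead x x<j
    ... | inj₂ refl = alj

  mainRun : ∀ {mem} → Copied mem →
      Runs P pc mem yesP (λ _ → AllDead survivors) (mainCost m n) ⊎ Runs P pc mem noP (λ _ → ∃ λ x → x < n × survivors x ≡ true) (mainCost m n)
  mainRun {mem} pre =
    (((fromExec {Q = λ mm → InitState 0 mm × mm 11 ≡ n}
        (step (ca 0 tt) tt refl (step (ca 1 tt) tt refl (step (ca 2 tt) tt refl (step (ca 3 tt) tt refl done)))) (S0 , trans (+-identityʳ _) cell1)
      >>> λ m1 (S , h11) → initLoop n 0 refl S h11)
      >>> λ m2 S2 → fromExec {Q = λ mm → Inv allAlive mm × mm 9 ≡ n}
        (step (ca 9 tt) tt refl (step (ca 10 tt) tt refl done)) (I0 m2 S2 , trans (cong₂ _+_ (InitState.q1 S2) (InitState.q17 S2)) (+-identityʳ n)))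
      >>> (λ m3 (I , h9) → sweepLoop n I h9))
    >>>⊎ λ m4 I4 →
      fromExec {Q = λ mm → Inv survivors mm × mm 13 ≡ base + 0 × mm 11 ≡ n}
        (step (ca 39 tt) tt refl (step (ca 40 tt) tt refl done))
        (scratch-update 11 _ (scratch-update 13 _ I4) , cong₂ _+_ (Inv.i3 I4) (Inv.i17 I4) , trans (cong₂ _+_ (Inv.i1 I4) (Inv.i17 I4)) (+-identityʳ n))
      >>>⊎ λ m5 (I5 , g13 , g11) → checkLoop n 0 survivors refl I5 g13 g11 (λ _ ())
    where
    open Copied pre
    S0 : InitState 0 _
    S0 = record
      { q0 = cell0 ; q1 = cell1 ; q2 = refl ; q3 = cell3 ; q17 = refl
      ; qmat = λ t t< → let x≥ = ≤-trans (base≤ n) (m≤m+n (base + n) t) in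
          trans (update-above _ 11 _ _ (register-below-base 11 tt x≥)) (trans (update-above _ 13 _ _ (register-below-base 13 tt x≥))
          (trans (update-above _ 17 _ _ (register-below-base 17 tt x≥)) (trans (update-above _ 2 _ _ (register-below-base 2 tt x≥)) (matrix t t<))))
      ; q13 = cong (_+ 0) cell3
      ; qal = λ x () }
    I0 : ∀ mm → InitState n mm → Inv allAlive (update (update mm 8 (mm 3 + mm 1)) 9 (mm 1 + mm 17))
    I0 mm S = record
      { i0 = q0 ; i1 = q1 ; i2 = q2 ; i3 = q3 ; i8 = cong₂ _+_ q3 q1 ; i17 = q17
      ; matrix = λ t t< → let x≥ = ≤-trans (base≤ n) (m≤m+n (base + n) t) in
          trans (update-above _ 9 _ _ (register-below-base 9 tt x≥)) (trans (update-above _ 8 _ _ (register-below-base 8 tt x≥)) (qmat t t<))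
      ; flags = λ j j< → trans (update-above _ 9 _ _ (register-below-base 9 tt (base≤ j))) (trans (update-above _ 8 _ _ (register-below-base 8 tt (base≤ j))) (qal j j<)) }
      where open InitState S

module CopyProof (m n : ℕ) (M : BoolMatrix m n) {P : Program} {C : ℕ} (ca : CodeAt P C (copyCode C)) where

  open Layout M

  record CopyState (s : ℕ) (mem : Memory) : Set where
    field
      k0 : mem 0 ≡ m
      k1 : mem 1 ≡ n
      k2 : mem 2 ≡ 1
      k3 : mem 3 ≡ base
      k4 : mem 4 ≡ base + n + (6 + s)
      k6 : mem 6 ≡ 8 + s
      src : ∀ x → 8 ≤ x → x < base → mem x ≡ enc x
      dst : ∀ t → t < 6 + s → mem (base + n + t) ≡ enc (2 + t)

  update-above-base : ∀ mem a v x → base ≤ a → T (x <ᵇ 22) → update mem a v x ≡ mem x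
  update-above-base mem a v x base≤a p = update-below mem a v x (register-below-base x p base≤a)

  input<base : ∀ x → x < m * n → 2 + x < base
  input<base x x< = <-≤-trans (+-monoʳ-< 2 x<) (subst (_≤ base) (+-comm (m * n) 2) (m≤m+n (m * n + 2) 20))

  copyLoop : ∀ c s {mem} → s + c ≡ m * n ∸ 6 → CopyState s mem → mem 5 ≡ c →
      Runs P (6 + C) mem (13 + C) Copied (c * 7 + 1)
  copyLoop zero s {mem} e St h5 = fromExec (step (ca 6 tt) tt (jz-zero 5 h5) done) record
    { cell0 = k0 ; cell1 = k1 ; cell3 = k3
    ; matrix = λ t t< → dst t (<-≤-trans t< mn≤) }
    where
    open CopyState St
    mn≤ : m * n ≤ 6 + s
    mn≤ = ≤-trans (m≤n+m∸n (m * n) 6) (≤-reflexive (cong (6 +_) (trans (sym e) (+-identityʳ s))))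
  copyLoop (suc c) s {mem} e St h5 =
    fromExec {Q = λ mm → CopyState (suc s) mm × mm 5 ≡ c}
      (step (ca 6 tt) tt (jz-suc 5 h5) (step (ca 7 tt) tt refl (step (ca 8 tt) tt refl
       (step (ca 9 tt) tt refl (step (ca 10 tt) tt refl (step (ca 11 tt) tt refl (step (ca 12 tt) tt refl done)))))))
      (St' , h5')
    >>> λ m1 (S1 , g5) → copyLoop c (suc s) (trans (sym (+-suc s c)) e) S1 g5
    where
    open CopyState St
    a = mem 4
    base≤a : base ≤ a
    base≤a = subst (base ≤_) (sym k4) (≤-trans (base≤ n) (m≤m+n (base + n) (6 + s)))
    m1 = update mem 7 (mem (mem 6))
    m2 = update m1 a (mem (mem 6))
    u : ∀ x → T (x <ᵇ 22) → m2 x ≡ m1 x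
    u x p = update-above-base m1 a _ x base≤a p
    6<mn : 6 < m * n
    6<mn = m∸n≢0⇒n<m (λ mn∸6≡0 → case trans (sym mn∸6≡0) (trans (sym e) (+-suc s c)) of λ ())
    s<mn : 6 + s < m * n
    s<mn = <-≤-trans (+-monoʳ-< 6 (m<m+n s (s≤s z≤n)))
             (≤-reflexive (trans (cong (6 +_) e) (m+[n∸m]≡n (<⇒≤ 6<mn))))
    src-read : mem (mem 6) ≡ enc (8 + s)
    src-read = trans (cong mem k6) (src (8 + s) (m≤m+n 8 s) (input<base (6 + s) s<mn))
    St' : CopyState (suc s) (update (update (update m2 6 (m2 6 + m2 2)) 4 (m2 4 + m2 2)) 5 (m2 5 ∸ m2 2))
    St' = record
      { k0 = trans (u 0 tt) k0 ; k1 = trans (u 1 tt) k1 ; k2 = trans (u 2 tt) k2 ; k3 = trans (u 3 tt) k3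
      ; k4 = trans (cong₂ _+_ (trans (u 4 tt) k4) (trans (u 2 tt) k2)) (m+n+1≡m+[1+n] (base + n) (6 + s))
      ; k6 = trans (cong₂ _+_ (trans (u 6 tt) k6) (trans (u 2 tt) k2)) (m+n+1≡m+[1+n] 8 s)
      ; src = λ x 8≤x x<base → trans (update-above _ 5 _ x (<-≤-trans (<ᵇ⇒< 5 8 tt) 8≤x))
                (trans (update-above _ 4 _ x (<-≤-trans (<ᵇ⇒< 4 8 tt) 8≤x))
                (trans (update-above _ 6 _ x (<-≤-trans (<ᵇ⇒< 6 8 tt) 8≤x))
                (trans (update-below m1 a _ x (<-≤-trans x<base base≤a))
                (trans (update-above _ 7 _ x (<-≤-trans (<ᵇ⇒< 7 8 tt) 8≤x)) (src x 8≤x x<base)))))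
      ; dst = dstN
      }
      where
      dstN : ∀ t → t < 6 + suc s → _
      dstN t t< = trans (update-above _ 5 _ _ (register-below-base 5 tt xa)) (trans (update-above _ 4 _ _ (register-below-base 4 tt xa)) (trans (update-above _ 6 _ _ (register-below-base 6 tt xa)) (go (m<1+n⇒m<n∨m≡n (subst (t <_) (+-suc 6 s) t<)))))
        where
        xa : base ≤ base + n + t
        xa = ≤-trans (base≤ n) (m≤m+n (base + n) t)
        go : t < 6 + s ⊎ t ≡ 6 + s → m2 (base + n + t) ≡ enc (2 + t)
        go (inj₂ refl) = trans (cong m2 (sym k4)) (trans (update-same m1 a _) src-read)
        go (inj₁ t<) = trans (update-other m1 a _ _ (λ eq → <-irrefl (+-cancelˡ-≡ (base + n) t (6 + s) (trans eq k4)) t<))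
                         (trans (update-above _ 7 _ _ (register-below-base 7 tt xa)) (dst t t<))
    h5' : update (update (update m2 6 (m2 6 + m2 2)) 4 (m2 4 + m2 2)) 5 (m2 5 ∸ m2 2) 5 ≡ c
    h5' = cong₂ _∸_ (trans (u 5 tt) h5) (trans (u 2 tt) k2)

  base∸28 : base ∸ 28 ≡ m * n ∸ 6
  base∸28 = trans (cong (_∸ 28) (trans (+-assoc (m * n) 2 20) (+-comm (m * n) 22))) ([m+n]∸[m+o]≡n∸o 22 (m * n) 6)

  copyRun : ∀ {mem} → Prepared mem → Runs P C mem (13 + C) Copied (copyCost m n)
  copyRun {mem} I =
    fromExec {Q = λ mm → CopyState 0 mm × mm 5 ≡ m * n ∸ 6}
      (step (ca 0 tt) tt refl (step (ca 1 tt) tt refl (step (ca 2 tt) tt refl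
       (step (ca 3 tt) tt refl (step (ca 4 tt) tt refl (step (ca 5 tt) tt refl done))))))
      (St , trans (cong (_∸ 28) cell3) base∸28)
    >>> λ m1 (S1 , g5) → copyLoop (m * n ∸ 6) 0 refl S1 g5
    where
    open Prepared I
    low : ∀ {x} d → T (d <ᵇ 8) → 8 ≤ x → d < x
    low d p 8≤x = <-≤-trans (<ᵇ⇒< d 8 p) 8≤x
    St = record
      { k0 = cell0 ; k1 = cell1 ; k2 = refl ; k3 = cell3
      ; k4 = cong (_+ 6) cell4 ; k6 = refl
      ; src = λ x 8≤x x<base → trans (update-above _ 4 _ x (low 4 tt 8≤x)) (trans (update-above _ 7 _ x (low 7 tt 8≤x))
               (trans (update-above _ 6 _ x (low 6 tt 8≤x)) (trans (update-above _ 2 _ x (low 2 tt 8≤x))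
               (trans (update-above _ 5 _ x (low 5 tt 8≤x)) (trans (update-above _ 2 _ x (low 2 tt 8≤x)) (input x 8≤x x<base))))))
      ; dst = λ t t< → let xa = ≤-trans (base≤ n) (m≤m+n (base + n) t) in
               trans (update-above _ 4 _ _ (register-below-base 4 tt xa)) (trans (update-above _ 7 _ _ (register-below-base 7 tt xa))
               (trans (update-above _ 6 _ _ (register-below-base 6 tt xa)) (trans (update-above _ 2 _ _ (register-below-base 2 tt xa))
               (trans (update-above _ 5 _ _ (register-below-base 5 tt xa)) (trans (update-above _ 2 _ _ (register-below-base 2 tt xa)) (copied t t<))))))
      }

module LeafProof (m n : ℕ) (M : BoolMatrix m n) {P : Program} {L C : ℕ} (b0 b1 b2 : Bool)
                 (ca : CodeAt P L (leafCode L C b0 b1 b2))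
                 (e2 : encode M 2 ≡ bit b0) (e3 : encode M 3 ≡ bit b1) (e4 : encode M 4 ≡ bit b2) where

  open Layout M

  record SizeState (mem : Memory) : Set where
    field
      f0 : mem 0 ≡ m
      f1 : mem 1 ≡ n
      f2 : mem 2 ≡ 1
      high : ∀ x → 5 ≤ x → mem x ≡ enc x

  multiplyLoop : ∀ c a {mem} → SizeState mem → mem 4 ≡ c → mem 3 ≡ a →
      Runs P (4 + L) mem (8 + L) (λ mm → SizeState mm × mm 3 ≡ c * n + a) (c * 4 + 1)
  multiplyLoop zero a {mem} S h4 h3 = fromExec (step (ca 4 tt) tt (jz-zero 4 h4) done) (S , h3)
  multiplyLoop (suc c) a {mem} S h4 h3 =
    fromExec {Q = λ mm → SizeState mm × mm 4 ≡ c × mm 3 ≡ a + n}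
      (step (ca 4 tt) tt (jz-suc 4 h4) (step (ca 5 tt) tt refl (step (ca 6 tt) tt refl (step (ca 7 tt) tt refl done))))
      (record { f0 = f0 ; f1 = f1 ; f2 = f2
              ; high = λ x 5≤x → trans (update-above _ 4 _ x (<-≤-trans (<ᵇ⇒< 4 5 tt) 5≤x)) (trans (update-above _ 3 _ x (<-≤-trans (<ᵇ⇒< 3 5 tt) 5≤x)) (high x 5≤x)) } ,
       cong₂ _∸_ h4 f2 , cong₂ _+_ h3 f1)
    >>> λ m1 (F1 , g4 , g3) → mapPost (λ mm (Fx , e) → Fx , trans e (+n-shift c a)) (multiplyLoop c (a + n) F1 g4 g3)
    where
    open SizeState S
    +n-shift : ∀ c a → c * n + (a + n) ≡ suc c * n + a
    +n-shift c a = trans (sym (+-assoc (c * n) a n)) (trans (+-comm (c * n + a) n) (sym (+-assoc n (c * n) a)))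

  -- Saved t: entry t is already at base + n + t; V5, V6, V7 are the values held in cells 5, 6, 7.
  record SaveState (Saved : ℕ → Set) (V5 V6 V7 : ℕ) (mem : Memory) : Set where
    field
      l0 : mem 0 ≡ m
      l1 : mem 1 ≡ n
      l3 : mem 3 ≡ base
      l4 : mem 4 ≡ base + n
      v5 : mem 5 ≡ V5
      v6 : mem 6 ≡ V6
      v7 : mem 7 ≡ V7
      input : ∀ x → 8 ≤ x → x < base → mem x ≡ enc x
      saved : ∀ t → Saved t → mem (base + n + t) ≡ enc (2 + t)

  saveRun : ∀ {Saved V5 V6 V7 mem} q k s → fetch P q ≡ just (const 2 k) → fetch P (suc q) ≡ just (add 2 4 2) →
      fetch P (2 + q) ≡ just (store 2 s) → 2 < s → mem s ≡ enc (2 + k) → SaveState Saved V5 V6 V7 mem →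
      Runs P q mem (3 + q) (SaveState (λ t → Saved t ⊎ t ≡ k) V5 V6 V7) 3
  saveRun {Saved} {V5} {V6} {V7} {mem} q k s fa fb fc 2<s ms St =
    fromExec (step fa tt refl (step fb tt refl (step fc tt refl done))) St'
    where
    open SaveState St
    m1 = update mem 2 k
    m2 = update m1 2 (m1 4 + m1 2)
    a = mem 4 + k
    base≤a : base ≤ a
    base≤a = subst (λ z → base ≤ z + k) (sym l4) (≤-trans (base≤ n) (m≤m+n (base + n) k))
    m2s : m2 s ≡ mem s
    m2s = trans (update-above m1 2 _ s 2<s) (update-above mem 2 k s 2<s)
    u : ∀ x → T (x <ᵇ 22) → update m2 a (m2 s) x ≡ m2 x
    u x p = update-below m2 a _ x (register-below-base x p base≤a)
    St' : SaveState (λ t → Saved t ⊎ t ≡ k) V5 V6 V7 (update m2 a (m2 s))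
    St' = record
      { l0 = trans (u 0 tt) l0 ; l1 = trans (u 1 tt) l1 ; l3 = trans (u 3 tt) l3 ; l4 = trans (u 4 tt) l4
      ; v5 = trans (u 5 tt) v5 ; v6 = trans (u 6 tt) v6 ; v7 = trans (u 7 tt) v7
      ; input = λ x 8≤x x<base → trans (update-below m2 a _ x (<-≤-trans x<base base≤a))
                 (trans (update-above m1 2 _ x (<-≤-trans (<ᵇ⇒< 2 8 tt) 8≤x)) (trans (update-above mem 2 _ x (<-≤-trans (<ᵇ⇒< 2 8 tt) 8≤x)) (input x 8≤x x<base)))
      ; saved = lsvN }
      where
      lsvN : ∀ t → Saved t ⊎ t ≡ k → update m2 a (m2 s) (base + n + t) ≡ enc (2 + t)
      lsvN t h with t ≟ k
      ... | yes refl = trans (cong (update m2 a (m2 s)) (cong (_+ t) (sym l4))) (trans (update-same m2 a _) (trans m2s ms))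
      ... | no t≢k with h
      ... | inj₂ e = ⊥-elim (t≢k e)
      ... | inj₁ sv = trans (update-other m2 a _ _ (λ eq → t≢k (+-cancelˡ-≡ (base + n) t k (trans eq (cong (_+ k) l4)))))
            (trans (update-above m1 2 _ _ (register-below-base 2 tt xa)) (trans (update-above mem 2 _ _ (register-below-base 2 tt xa)) (saved t sv)))
        where
        xa : base ≤ base + n + t
        xa = ≤-trans (base≤ n) (m≤m+n (base + n) t)

  FirstSix : ℕ → Set
  FirstSix t = (((((⊥ ⊎ t ≡ 3) ⊎ t ≡ 4) ⊎ t ≡ 5) ⊎ t ≡ 0) ⊎ t ≡ 1) ⊎ t ≡ 2

  firstSix : ∀ t → t < 6 → FirstSix t
  firstSix 0 _ = inj₁ (inj₁ (inj₂ refl))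
  firstSix 1 _ = inj₁ (inj₂ refl)
  firstSix 2 _ = inj₂ refl
  firstSix 3 _ = inj₁ (inj₁ (inj₁ (inj₁ (inj₁ (inj₂ refl)))))
  firstSix 4 _ = inj₁ (inj₁ (inj₁ (inj₁ (inj₂ refl))))
  firstSix 5 _ = inj₁ (inj₁ (inj₁ (inj₂ refl)))
  firstSix (suc (suc (suc (suc (suc (suc t)))))) (s≤s (s≤s (s≤s (s≤s (s≤s (s≤s ()))))))

  bitsLoaded : ∀ {Saved mem} → SaveState Saved (enc 5) (enc 6) (enc 7) mem →
      SaveState Saved (bit b0) (bit b1) (bit b2) (update (update (update mem 5 (bit b0)) 6 (bit b1)) 7 (bit b2))
  bitsLoaded St = record
    { l0 = l0 ; l1 = l1 ; l3 = l3 ; l4 = l4 ; v5 = refl ; v6 = refl ; v7 = refl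
    ; input = λ x 8≤x x<base → trans (update-above _ 7 _ x (<-≤-trans (<ᵇ⇒< 7 8 tt) 8≤x)) (trans (update-above _ 6 _ x (<-≤-trans (<ᵇ⇒< 6 8 tt) 8≤x))
              (trans (update-above _ 5 _ x (<-≤-trans (<ᵇ⇒< 5 8 tt) 8≤x)) (input x 8≤x x<base)))
    ; saved = λ t sv → let xa = ≤-trans (base≤ n) (m≤m+n (base + n) t) in
              trans (update-above _ 7 _ _ (register-below-base 7 tt xa)) (trans (update-above _ 6 _ _ (register-below-base 6 tt xa)) (trans (update-above _ 5 _ _ (register-below-base 5 tt xa)) (saved t sv))) }
    where open SaveState St

  leafRun : ∀ {mem} → (∀ x → mem x ≡ enc x) → Runs P L mem C Prepared (leafCost m)
  leafRun {mem} hm =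
    fromExec {Q = λ mm → SizeState mm × mm 4 ≡ m × mm 3 ≡ 2}
      (step (ca 0 tt) tt refl (step (ca 1 tt) tt refl (step (ca 2 tt) tt refl (step (ca 3 tt) tt refl done))))
      (S0 , hm 0 , refl)
    >>> λ m1 (F1 , g4 , g3) → multiplyLoop m 2 F1 g4 g3
    >>> λ m2 (F2 , g3') →
    fromExec {Q = SaveState (λ _ → ⊥) (enc 5) (enc 6) (enc 7)}
      (step (ca 8 tt) tt refl (step (ca 9 tt) tt refl (step (ca 10 tt) tt refl done)))
      (T0 m2 F2 g3')
    >>> λ m3 S3 → saveRun (11 + L) 3 5 (ca 11 tt) (ca 12 tt) (ca 13 tt) (<ᵇ⇒< 2 5 tt) (SaveState.v5 S3) S3
    >>> λ m4 S4 → saveRun (14 + L) 4 6 (ca 14 tt) (ca 15 tt) (ca 16 tt) (<ᵇ⇒< 2 6 tt) (SaveState.v6 S4) S4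
    >>> λ m5 S5 → saveRun (17 + L) 5 7 (ca 17 tt) (ca 18 tt) (ca 19 tt) (<ᵇ⇒< 2 7 tt) (SaveState.v7 S5) S5
    >>> λ m6 S6 → fromExec (step (ca 20 tt) tt refl (step (ca 21 tt) tt refl (step (ca 22 tt) tt refl done))) (bitsLoaded S6)
    >>> λ m7 S7 → saveRun (23 + L) 0 5 (ca 23 tt) (ca 24 tt) (ca 25 tt) (<ᵇ⇒< 2 5 tt) (trans (SaveState.v5 S7) (sym e2)) S7
    >>> λ m8 S8 → saveRun (26 + L) 1 6 (ca 26 tt) (ca 27 tt) (ca 28 tt) (<ᵇ⇒< 2 6 tt) (trans (SaveState.v6 S8) (sym e3)) S8
    >>> λ m9 S9 → saveRun (29 + L) 2 7 (ca 29 tt) (ca 30 tt) (ca 31 tt) (<ᵇ⇒< 2 7 tt) (trans (SaveState.v7 S9) (sym e4)) S9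
    >>> λ m10 S10 → fromExec (step (ca 32 tt) tt refl done) (out S10)
    where
    S0 = record { f0 = hm 0 ; f1 = hm 1 ; f2 = refl
                ; high = λ x 5≤x → trans (update-above _ 4 _ x (<-≤-trans (<ᵇ⇒< 4 5 tt) 5≤x)) (trans (update-above _ 4 _ x (<-≤-trans (<ᵇ⇒< 4 5 tt) 5≤x))
                         (trans (update-above _ 3 _ x (<-≤-trans (<ᵇ⇒< 3 5 tt) 5≤x)) (trans (update-above _ 2 _ x (<-≤-trans (<ᵇ⇒< 2 5 tt) 5≤x)) (hm x)))) }
    T0 : ∀ mm → SizeState mm → mm 3 ≡ m * n + 2 → SaveState (λ _ → ⊥) (enc 5) (enc 6) (enc 7) (update (update (update mm 4 20) 3 (mm 3 + 20)) 4 ((mm 3 + 20) + mm 1))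
    T0 mm S h3 = record
      { l0 = SizeState.f0 S ; l1 = SizeState.f1 S ; l3 = cong (_+ 20) h3 ; l4 = cong₂ _+_ (cong (_+ 20) h3) (SizeState.f1 S)
      ; v5 = SizeState.high S 5 (<ᵇ⇒< 4 5 tt) ; v6 = SizeState.high S 6 (<ᵇ⇒< 4 6 tt) ; v7 = SizeState.high S 7 (<ᵇ⇒< 4 7 tt)
      ; input = λ x 8≤x _ → trans (update-above _ 4 _ x (<-≤-trans (<ᵇ⇒< 4 8 tt) 8≤x)) (trans (update-above _ 3 _ x (<-≤-trans (<ᵇ⇒< 3 8 tt) 8≤x))
                (trans (update-above _ 4 _ x (<-≤-trans (<ᵇ⇒< 4 8 tt) 8≤x)) (SizeState.high S x (≤-trans (<ᵇ⇒< 4 8 tt) 8≤x))))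
      ; saved = λ t () }
    out : ∀ {mm} → SaveState FirstSix (bit b0) (bit b1) (bit b2) mm → Prepared mm
    out St = record { cell0 = l0 ; cell1 = l1 ; cell3 = l3 ; cell4 = l4 ; input = input ; copied = λ t t< → saved t (firstSix t t<) }
      where open SaveState St


branch : ∀ {pc r t₀ t₁ b mem} → fetch program pc ≡ just (jz r t₀) → fetch program (suc pc) ≡ just (jmp t₁) →
         mem r ≡ bit b → Runs program pc mem (if b then t₁ else t₀) (_≡ mem) 2
branch {b = false} f₀ f₁ e = weaken (≤ᵇ⇒≤ 1 2 tt) (fromExec (step f₀ tt (jz-zero _ e) done) refl)
branch {b = true}  f₀ f₁ e = fromExec (step f₀ tt (jz-suc _ e) (step f₁ tt refl done)) refl

treeRun : ∀ {mem} b₀ b₁ b₂ → mem 2 ≡ bit b₀ → mem 3 ≡ bit b₁ → mem 4 ≡ bit b₂ →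
          Runs program 2 mem (leafPos b₀ b₁ b₂) (_≡ mem) 6
treeRun false false false e₂ e₃ e₄ = branch refl refl e₂ >>> (λ { _ refl → branch refl refl e₃ }) >>> λ { _ refl → branch refl refl e₄ }
treeRun false false true  e₂ e₃ e₄ = branch refl refl e₂ >>> (λ { _ refl → branch refl refl e₃ }) >>> λ { _ refl → branch refl refl e₄ }
treeRun false true  false e₂ e₃ e₄ = branch refl refl e₂ >>> (λ { _ refl → branch refl refl e₃ }) >>> λ { _ refl → branch refl refl e₄ }
treeRun false true  true  e₂ e₃ e₄ = branch refl refl e₂ >>> (λ { _ refl → branch refl refl e₃ }) >>> λ { _ refl → branch refl refl e₄ }
treeRun true  false false e₂ e₃ e₄ = branch refl refl e₂ >>> (λ { _ refl → branch refl refl e₃ }) >>> λ { _ refl → branch refl refl e₄ }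
treeRun true  false true  e₂ e₃ e₄ = branch refl refl e₂ >>> (λ { _ refl → branch refl refl e₃ }) >>> λ { _ refl → branch refl refl e₄ }
treeRun true  true  false e₂ e₃ e₄ = branch refl refl e₂ >>> (λ { _ refl → branch refl refl e₃ }) >>> λ { _ refl → branch refl refl e₄ }
treeRun true  true  true  e₂ e₃ e₄ = branch refl refl e₂ >>> (λ { _ refl → branch refl refl e₃ }) >>> λ { _ refl → branch refl refl e₄ }

record Decided {m n : ℕ} (M : BoolMatrix m n) : Set where
  field
    steps  : ℕ
    pc′    : ℕ
    final  : Memory
    exec   : Exec program 0 (encode M) steps pc′ final
    halted : fetch program pc′ ≡ just halt
    bound  : steps ≤ 216 * (n ! * m + 1)
    answer : Decides M (final 0)

module Nonempty (a b : ℕ) (M : BoolMatrix (suc a) (suc b)) where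

  open Layout M
  open Peeling (suc a) (suc b) entry
  open Independence M entry entry≡M

  b₀ b₁ b₂ : Bool
  b₀ = proj₁ (encode-IsBit M 0)
  b₁ = proj₁ (encode-IsBit M 1)
  b₂ = proj₁ (encode-IsBit M 2)

  e₂ : enc 2 ≡ bit b₀
  e₂ = proj₂ (encode-IsBit M 0)
  e₃ : enc 3 ≡ bit b₁
  e₃ = proj₂ (encode-IsBit M 1)
  e₄ : enc 4 ≡ bit b₂
  e₄ = proj₂ (encode-IsBit M 2)

  module Leaf = LeafProof (suc a) (suc b) M {program} {leafPos b₀ b₁ b₂} {copyPos} b₀ b₁ b₂ (leafAt b₀ b₁ b₂) e₂ e₃ e₄
  module Copy = CopyProof (suc a) (suc b) M {program} {copyPos} copyAt
  module Main = MainProof (suc a) (suc b) M {program} {mainPos} {yesPos} {noPos} mainAt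

  sizesNonzero : Runs program 0 enc 2 (_≡ enc) 2
  sizesNonzero = fromExec
    (step {i = jz 0 tailPos} refl tt (jz-suc 0 {t = tailPos} {pc = 0} {mem = enc} {v = a} refl)
    (step {i = jz 1 yesPos}  refl tt (jz-suc 1 {t = yesPos}  {pc = 1} {mem = enc} {v = b} refl) done))
    refl

  toMain : Runs program 0 enc mainPos Copied (prefixCost (suc a) (suc b))
  toMain =
    sizesNonzero
    >>> (λ { _ refl → treeRun b₀ b₁ b₂ e₂ e₃ e₄ })
    >>> (λ { _ refl → Leaf.leafRun (λ _ → refl) })
    >>> λ _ prepared → Copy.copyRun prepared

  Outcome : Set
  Outcome = Runs program 0 enc yesPos (λ _ → AllDead survivors) (prefixCost (suc a) (suc b) + mainCost (suc a) (suc b))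
          ⊎ Runs program 0 enc noPos (λ _ → ∃ λ x → x < suc b × survivors x ≡ true) (prefixCost (suc a) (suc b) + mainCost (suc a) (suc b))

  conclude : Outcome → Decided M
  conclude (inj₁ (runs k mem e k≤ dead)) = record
    { steps = k + 1 ; pc′ = suc yesPos ; final = update mem 0 1
    ; exec = exec-++ e (step refl tt refl done) ; halted = refl
    ; bound = ≤-trans (+-monoˡ-≤ 1 k≤) (totalCost≤ a b)
    ; answer = inj₁ (refl , peeled-independent (peeled-sweeps (suc b)) dead) }
  conclude (inj₂ (runs k mem e k≤ (x , x<n , alive))) = record
    { steps = k + 1 ; pc′ = suc noPos ; final = update mem 0 0
    ; exec = exec-++ e (step refl tt refl done) ; halted = refl
    ; bound = ≤-trans (+-monoˡ-≤ 1 k≤) (totalCost≤ a b)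
    ; answer = inj₂ (refl , λ ind → case trans (sym alive) (survivors-dead (independent⇒AlwaysPeelable ind) x x<n) of λ ()) }

  decided : Decided M
  decided = conclude (toMain >>>⊎ λ _ copied → Main.mainRun copied)

no-columns-independent : ∀ {m} (M : BoolMatrix m 0) → AllColumnsIndependent M
no-columns-independent M = ∅ , record
  { k = 0 ; r = λ () ; c = λ () ; r-inj = λ {} ; c-inj = λ {} ; r-in = λ () ; c-in = λ ()
  ; r-onto = λ _ y∈⊥ → ⊥-elim (∉⊥ y∈⊥) ; c-onto = λ () ; diag = λ () ; upper = λ () }

no-rows-dependent : ∀ {n} (M : BoolMatrix 0 (suc n)) → ¬ AllColumnsIndependent M
no-rows-dependent M (_ , ns) with NonsingularOn.c-onto ns Fin.zero ∈⊤
... | i , _ with NonsingularOn.r ns i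
... | ()

few-steps : ∀ k x → T (k ≤ᵇ 216) → k ≤ 216 * (x + 1)
few-steps k x p = ≤-trans (≤ᵇ⇒≤ k 216 p) (*-monoʳ-≤ 216 (m≤n+m 1 x))

decide : ∀ m n (M : BoolMatrix m n) → Decided M
decide zero zero M = record
  { steps = 3 ; pc′ = suc yesPos ; final = update (encode M) 0 1
  ; exec = step {i = jz 0 tailPos} refl tt (jz-zero 0 {t = tailPos} {pc = 0} {mem = encode M} refl)
           (step {i = jz 1 yesPos} refl tt (jz-zero 1 {t = yesPos} {pc = tailPos} {mem = encode M} refl)
           (step {i = const 0 1} refl tt refl done))
  ; halted = refl ; bound = few-steps 3 0 tt ; answer = inj₁ (refl , no-columns-independent M) }
decide zero (suc n) M = record
  { steps = 4 ; pc′ = suc noPos ; final = update (encode M) 0 0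
  ; exec = step {i = jz 0 tailPos} refl tt (jz-zero 0 {t = tailPos} {pc = 0} {mem = encode M} refl)
           (step {i = jz 1 yesPos} refl tt (jz-suc 1 {t = yesPos} {pc = tailPos} {mem = encode M} {v = n} refl)
           (step {i = jmp noPos} refl tt refl (step {i = const 0 0} refl tt refl done)))
  ; halted = refl ; bound = few-steps 4 (suc n ! * 0) tt ; answer = inj₂ (refl , no-rows-dependent M) }
decide (suc a) zero M = record
  { steps = 3 ; pc′ = suc yesPos ; final = update (encode M) 0 1
  ; exec = step {i = jz 0 tailPos} refl tt (jz-suc 0 {t = tailPos} {pc = 0} {mem = encode M} {v = a} refl)
           (step {i = jz 1 yesPos} refl tt (jz-zero 1 {t = yesPos} {pc = 1} {mem = encode M} refl)
           (step {i = const 0 1} refl tt refl done))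
  ; halted = refl ; bound = few-steps 3 (0 ! * suc a) tt ; answer = inj₁ (refl , no-columns-independent M) }
decide (suc a) (suc b) M = Nonempty.decided a b M

lemma7p1 : Σ Program λ P → Σ ℕ λ c →
    ∀ (m n : ℕ) (M : BoolMatrix m n) →
      Σ Memory λ mem' →
        (run (c * ((n !) * m + 1)) P 0 (encode M) ≡ just mem')
        × Decides M (mem' 0)
lemma7p1 = program , 216 , λ m n M →
  let open Decided (decide m n M) in final , run-exec-halt exec halted _ bound , answer
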